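{- Let $\Delta$ be of type $C_p$ ($p\ge2$). For each $k=0,1,\dots,p-1$, the number of $k$-element short antichains $\Gamma$ of $\Delta^+$ with $\Gamma\cap\Pi_s=\emptyset$ equals $\binom{p-1}{k}^2$.
   Context: $\Delta^+$ is a positive system of the root system of type $C_p$, with simple roots $\Pi$ and short simple roots $\Pi_s$. On $\Delta^+$, $\mu\preccurlyeq\gamma$ iff $\gamma-\mu$ is a nonnegative integer combination of simple roots; an antichain is a set of pairwise incomparable positive roots, short if it consists of short roots. -}

module Defs where

open import Data.Bool using (Bool; true; false; if_then_else_)
open import Data.Nat as ℕ using (ℕ; zero; suc; _≡ᵇ_; _<ᵇ_)
open import Data.Integer as ℤ using (ℤ; +_)
open import Data.Fin using (Fin; toℕ)
open import Data.Vec as Vec using (Vec; tabulate; zipWith; foldr)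
open import Data.List as List using (List; []; _∷_; _++_; concatMap; allFin; length; lookup)
open import Data.List.Relation.Unary.Unique.Propositional using (Unique)
open import Data.List.Membership.Propositional using () renaming (_∈_ to _∈ᴸ_)
open import Data.Fin.Subset using (Subset; _∈_; ∣_∣)
open import Data.Product using (Σ; _×_; ∃)
open import Relation.Binary.PropositionalEquality using (_≡_; _≢_)
open import Function.Bundles using (_⇔_)

-- Ambient space ℤ^p, with standard basis e_0 , … , e_{p-1} (0-indexed).
V : ℕ → Set
V p = Vec ℤ p

infixl 6 _⊕_ _⊖_
_⊕_ : ∀ {p} → V p → V p → V p
_⊕_ = zipWith ℤ._+_

_⊖_ : ∀ {p} → V p → V p → V p
_⊖_ = zipWith ℤ._-_

_·_ : ∀ {p} → ℤ → V p → V p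
c · v = Vec.map (c ℤ.*_) v

zeroV : ∀ {p} → V p
zeroV = Vec.replicate _ (+ 0)

-- e n = n-th standard basis vector (the zero vector if n ≥ p)
e : ∀ {p} → ℕ → V p
e n = tabulate (λ j → if toℕ j ≡ᵇ n then + 1 else + 0)

⟨_,_⟩ : ∀ {p} → V p → V p → ℤ
⟨ u , v ⟩ = foldr _ ℤ._+_ (+ 0) (zipWith ℤ._*_ u v)

posRoots : (p : ℕ) → List (V p)
posRoots p = concatMap
  (λ i → concatMap
           (λ j → if toℕ i <ᵇ toℕ j
                  then (e (toℕ i) ⊖ e (toℕ j)) ∷ (e (toℕ i) ⊕ e (toℕ j)) ∷ []
                  else [])
           (allFin p)
         ++ ((+ 2) · e (toℕ i) ∷ []))
  (allFin p)

α : ∀ {p} → Fin p → V p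
α {p} i = if suc (toℕ i) ≡ᵇ p then (+ 2) · e (toℕ i) else e (toℕ i) ⊖ e (suc (toℕ i))

IsShort : ∀ {p} → V p → Set
IsShort γ = ⟨ γ , γ ⟩ ≡ + 2

InΠs : ∀ {p} → V p → Set
InΠs {p} γ = Σ (Fin p) λ i → γ ≡ α i × IsShort (α i)

combo : ∀ {p} → (Fin p → ℕ) → V p
combo {p} c = List.foldr (λ i acc → (+ c i) · α i ⊕ acc) zeroV (allFin p)

_≼_ : ∀ {p} → V p → V p → Set
_≼_ {p} μ γ = Σ (Fin p → ℕ) λ c → γ ⊖ μ ≡ combo c

-- Subsets of Δ⁺ are subsets of the index set of the enumeration posRoots p
N : ℕ → ℕ
N p = length (posRoots p)

root : (p : ℕ) → Fin (N p) → V p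
root p = lookup (posRoots p)

IsAntichain : (p : ℕ) → Subset (N p) → Set
IsAntichain p Γ = ∀ x y → x ∈ Γ → y ∈ Γ → x ≢ y →
  (root p x ≼ root p y → Data.Empty.⊥)
  where import Data.Empty

IsShortAntichain : (p : ℕ) → Subset (N p) → Set
IsShortAntichain p Γ = IsAntichain p Γ × (∀ x → x ∈ Γ → IsShort (root p x))

DisjointΠs : (p : ℕ) → Subset (N p) → Set
DisjointΠs p Γ = ∀ x → x ∈ Γ → InΠs (root p x) → Data.Empty.⊥
  where import Data.Empty

NumberOf : ∀ {m} → (Subset m → Set) → ℕ → Set
NumberOf {m} P n = Σ (List (Subset m)) λ L →
  Unique L × (∀ s → (s ∈ᴸ L) ⇔ P s) × length L ≡ n

{-# OPTIONS --safe #-}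
module Submission where

open import Defs
open import Data.Nat using (ℕ; _≤_; _<_; _∸_; _^_)
open import Data.Nat.Combinatorics using (_C_)
open import Data.Fin.Subset using (∣_∣)
open import Data.Product using (_×_)
open import Relation.Binary.PropositionalEquality using (_≡_)
open import Data.Nat using (zero; suc; s≤s)

-- Write p = r + 2.  The short positive roots outside Π_s are e_a − e_c (c ≥ a + 2) and e_a + e_c
-- (a < c); sending (a , b) to e_a − e_{b+2} for b < r and to e_a + e_{2r+1−b} for b ≥ r identifies
-- them with the lattice points of the triangle a ≤ b, a + b ≤ 2r.  Lowering a or raising b adds a
-- simple root, while prefix sums of coordinates, being nonnegative on simple roots, separate the
-- roots of two points strictly ordered in both coordinates.  So the k-element antichains in question
-- are the point sets of the k-chains of the triangle strictly decreasing in both coordinates.  These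
-- are counted column by column: away from the anti-diagonal the reflection principle gives
-- C(m,k)C(B,k) − C(m,k+1)C(B,k−1) chains in [0,m) × [0,B), and Pascal's rule then gives C(r+1,k)²
-- for the whole triangle.

module ListFacts where

  open import Data.Nat using (suc)
  open import Data.Fin as Fin using (Fin)
  open import Data.Fin.Properties using (suc-injective)
  open import Data.Fin.Subset using (Subset; inside; outside; ∣_∣) renaming (_∈_ to _∈ₛ_)
  open import Data.Vec as Vec using ([]; _∷_; here; there)
  import Data.Vec.Properties as Vec
  open import Data.List as List using (List; []; _∷_; length; concatMap; lookup)
  open import Data.List.Properties using (length-map)
  open import Data.List.Membership.Propositional using (_∈_)
  open import Data.List.Membership.Propositional.Properties
    using (∈-concatMap⁻; ∈-map⁺; ∈-map⁻; ∈-lookup)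
  open import Data.List.Membership.Propositional.Properties.WithK using (unique∧set⇒bag)
  open import Data.List.Relation.Unary.Any using (here; there)
  open import Data.List.Relation.Unary.All as All using (All; []; _∷_)
  import Data.List.Relation.Unary.All.Properties as All
  open import Data.List.Relation.Unary.AllPairs as AllPairs using (AllPairs; []; _∷_)
  import Data.List.Relation.Unary.AllPairs.Properties as AllPairs
  open import Data.List.Relation.Unary.Unique.Propositional using (Unique)
  import Data.List.Relation.Unary.Unique.Propositional.Properties as Unique
  open import Data.List.Relation.Binary.BagAndSetEquality using (∼bag⇒↭)
  open import Data.List.Relation.Binary.Permutation.Propositional.Properties using (↭-length)
  open import Data.Product using (_,_)
  open import Data.Sum using (_⊎_; inj₁; inj₂)
  open import Data.Empty using (⊥-elim)
  open import Function using (_∘_; _⇔_; mk⇔; Equivalence)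
  open import Relation.Nullary using (does; yes)
  open import Relation.Nullary.Decidable using (dec-true)
  open import Relation.Unary using (Decidable)
  open import Relation.Binary using (Asymmetric)
  open import Relation.Binary.PropositionalEquality

  private variable
    A B : Set

  concatMap-unique : (f : A → List B) {xs : List A} → Unique xs → (∀ x → Unique (f x)) →
    (∀ {x y v} → v ∈ f x → v ∈ f y → x ≡ y) → Unique (concatMap f xs)
  concatMap-unique f uxs uf shared =
    Unique.concat⁺ (All.map⁺ (All.tabulate (λ {x} _ → uf x)))
      (AllPairs.map⁺ {f = f} (AllPairs.map (λ x≢y {_} (v∈fx , v∈fy) → x≢y (shared v∈fx v∈fy)) uxs))

  map-unique-on : (f : A → B) {xs : List A} → (∀ {x y} → x ∈ xs → y ∈ xs → f x ≡ f y → x ≡ y) →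
    Unique xs → Unique (List.map f xs)
  map-unique-on f inj [] = []
  map-unique-on f inj (x∉ ∷ u) =
    All.map⁺ (All.tabulate (λ y∈ fx≡fy → All.lookup x∉ y∈ (inj (here refl) (there y∈) fx≡fy)))
    ∷ map-unique-on f (λ x∈ y∈ → inj (there x∈) (there y∈)) u

  lookup-injective : {xs : List A} → Unique xs → ∀ i j → lookup xs i ≡ lookup xs j → i ≡ j
  lookup-injective {xs = _ ∷ _} _        Fin.zero    Fin.zero    _  = refl
  lookup-injective {xs = _ ∷ _} (x∉ ∷ _) Fin.zero    (Fin.suc j) eq = ⊥-elim (All.lookup x∉ (∈-lookup j) eq)
  lookup-injective {xs = _ ∷ _} (x∉ ∷ _) (Fin.suc i) Fin.zero    eq = ⊥-elim (All.lookup x∉ (∈-lookup i) (sym eq))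
  lookup-injective {xs = _ ∷ _} (_  ∷ u) (Fin.suc i) (Fin.suc j) eq = cong Fin.suc (lookup-injective u i j eq)

  module _ {R : A → A → Set} where

    AllPairs-connex : ∀ {xs x y} → AllPairs R xs → x ∈ xs → y ∈ xs → x ≢ y → R x y ⊎ R y x
    AllPairs-connex (_  ∷ _)  (here refl) (here refl) x≢y = ⊥-elim (x≢y refl)
    AllPairs-connex (Rx ∷ _)  (here refl) (there y∈)  _   = inj₁ (All.lookup Rx y∈)
    AllPairs-connex (Ry ∷ _)  (there x∈)  (here refl) _   = inj₂ (All.lookup Ry x∈)
    AllPairs-connex (_  ∷ rs) (there x∈)  (there y∈)  x≢y = AllPairs-connex rs x∈ y∈ x≢y

    AllPairs-upgrade : ∀ {P : A → Set} {S : A → A → Set} {xs} → (∀ {x y} → P x → P y → R x y → S x y) →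
      All P xs → AllPairs R xs → AllPairs S xs
    AllPairs-upgrade up [] [] = []
    AllPairs-upgrade up (Px ∷ Ps) (Rx ∷ rs) =
      All.zipWith (λ (Py , Rxy) → up Px Py Rxy) (Ps , Rx) ∷ AllPairs-upgrade up Ps rs

    AllPairs-set⇒≡ : Asymmetric R → ∀ {xs ys} → AllPairs R xs → AllPairs R ys →
      (∀ {z} → z ∈ xs ⇔ z ∈ ys) → xs ≡ ys
    AllPairs-set⇒≡ asym {[]} {[]} _ _ _ = refl
    AllPairs-set⇒≡ asym {[]} {y ∷ _} _ _ same with () ← Equivalence.from same (here refl)
    AllPairs-set⇒≡ asym {x ∷ _} {[]} _ _ same with () ← Equivalence.to same (here refl)
    AllPairs-set⇒≡ asym {x ∷ xs} {y ∷ ys} (Rx ∷ rxs) (Ry ∷ rys) same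
      with Equivalence.to same (here refl) | Equivalence.from same (here refl)
    ... | there x∈ys | there y∈xs = ⊥-elim (asym (All.lookup Rx y∈xs) (All.lookup Ry x∈ys))
    ... | there x∈ys | here refl  = ⊥-elim (asym (All.lookup Ry x∈ys) (All.lookup Ry x∈ys))
    ... | here refl  | _          = cong (x ∷_) (AllPairs-set⇒≡ asym rxs rys (mk⇔ to from))
      where
        to : ∀ {z} → z ∈ xs → z ∈ ys
        to {z} z∈ with Equivalence.to same (there z∈)
        ... | here refl = ⊥-elim (asym (All.lookup Rx z∈) (All.lookup Rx z∈))
        ... | there z∈ys = z∈ys
        from : ∀ {z} → z ∈ ys → z ∈ xs
        from {z} z∈ with Equivalence.from same (there z∈)
        ... | here refl = ⊥-elim (asym (All.lookup Ry z∈) (All.lookup Ry z∈))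
        ... | there z∈xs = z∈xs

  unique-set⇒length≡ : {xs ys : List A} → Unique xs → Unique ys →
    (∀ {z} → z ∈ xs ⇔ z ∈ ys) → length xs ≡ length ys
  unique-set⇒length≡ uxs uys same = ↭-length (∼bag⇒↭ (unique∧set⇒bag uxs uys same))

  members : ∀ {n} → Subset n → List (Fin n)
  members []            = []
  members (inside  ∷ Γ) = Fin.zero ∷ List.map Fin.suc (members Γ)
  members (outside ∷ Γ) = List.map Fin.suc (members Γ)

  ∈-members⇔ : ∀ {n} {Γ : Subset n} {x} → x ∈ members Γ ⇔ x ∈ₛ Γ
  ∈-members⇔ = mk⇔ to from
    where
      to : ∀ {n} {Γ : Subset n} {x} → x ∈ members Γ → x ∈ₛ Γ
      to {Γ = inside ∷ Γ} (here refl) = here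
      to {Γ = inside ∷ Γ} (there x∈) with _ , y∈ , refl ← ∈-map⁻ Fin.suc x∈ = there (to y∈)
      to {Γ = outside ∷ Γ} x∈ with _ , y∈ , refl ← ∈-map⁻ Fin.suc x∈ = there (to y∈)
      from : ∀ {n} {Γ : Subset n} {x} → x ∈ₛ Γ → x ∈ members Γ
      from {Γ = inside ∷ Γ} here = here refl
      from {Γ = inside ∷ Γ} (there x∈) = there (∈-map⁺ Fin.suc (from x∈))
      from {Γ = outside ∷ Γ} (there x∈) = ∈-map⁺ Fin.suc (from x∈)

  members-unique : ∀ {n} (Γ : Subset n) → Unique (members Γ)
  members-unique [] = []
  members-unique (inside ∷ Γ) =
    All.map⁺ (All.tabulate (λ _ ())) ∷ Unique.map⁺ suc-injective (members-unique Γ)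
  members-unique (outside ∷ Γ) = Unique.map⁺ suc-injective (members-unique Γ)

  ∣Γ∣≡length-members : ∀ {n} (Γ : Subset n) → ∣ Γ ∣ ≡ length (members Γ)
  ∣Γ∣≡length-members [] = refl
  ∣Γ∣≡length-members (inside ∷ Γ) =
    cong suc (trans (∣Γ∣≡length-members Γ) (sym (length-map Fin.suc (members Γ))))
  ∣Γ∣≡length-members (outside ∷ Γ) =
    trans (∣Γ∣≡length-members Γ) (sym (length-map Fin.suc (members Γ)))

  subsetOf : ∀ {n} {P : Fin n → Set} → Decidable P → Subset n
  subsetOf P? = Vec.tabulate (λ x → does (P? x))

  ∈-subsetOf⇔ : ∀ {n} {P : Fin n → Set} (P? : Decidable P) {x} → x ∈ₛ subsetOf P? ⇔ P x
  ∈-subsetOf⇔ {P = P} P? {x} = mk⇔ to from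
    where
      to : x ∈ₛ subsetOf P? → P x
      to x∈ with P? x | trans (sym (Vec.lookup∘tabulate (λ x → does (P? x)) x)) (Vec.[]=⇒lookup x∈)
      ... | yes Px | _ = Px
      from : P x → x ∈ₛ subsetOf P?
      from Px = Vec.lookup⇒[]= x _ (trans (Vec.lookup∘tabulate (λ x → does (P? x)) x) (dec-true (P? x) Px))

module Vectors where

  open import Defs
  open import Data.Nat using (ℕ; zero; suc; _<_; _≤_; s≤s; _<ᵇ_)
  import Data.Vec.Properties as Vec
  open import Data.Integer as ℤ using (ℤ; +_; _+_; _*_; _-_)
  import Data.Integer.Properties as ℤ
  open import Data.Integer.Solver using (module +-*-Solver)
  open import Data.Vec as Vec using ([]; _∷_)
  open import Data.Bool using (if_then_else_)
  open import Relation.Binary.PropositionalEquality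
  open +-*-Solver

  private variable p : ℕ

  ⊕-comm : (x y : V p) → x ⊕ y ≡ y ⊕ x
  ⊕-comm []      []      = refl
  ⊕-comm (a ∷ x) (b ∷ y) = cong₂ _∷_ (ℤ.+-comm a b) (⊕-comm x y)

  ⊖-self : (x : V p) → x ⊖ x ≡ zeroV
  ⊖-self []      = refl
  ⊖-self (a ∷ x) = cong₂ _∷_ (ℤ.+-inverseʳ a) (⊖-self x)

  ⊖-telescope : (x y z : V p) → (x ⊖ y) ⊕ (y ⊖ z) ≡ x ⊖ z
  ⊖-telescope []      []      []      = refl
  ⊖-telescope (a ∷ x) (b ∷ y) (c ∷ z) =
    cong₂ _∷_ (solve 3 (λ a b c → (a :- b) :+ (b :- c) := a :- c) refl a b c) (⊖-telescope x y z)

  ⊕-⊖-cancelˡ : (x y : V p) → (x ⊕ y) ⊖ x ≡ y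
  ⊕-⊖-cancelˡ []      []      = refl
  ⊕-⊖-cancelˡ (a ∷ x) (b ∷ y) =
    cong₂ _∷_ (solve 2 (λ a b → (a :+ b) :- a := b) refl a b) (⊕-⊖-cancelˡ x y)

  ⊖-⊕-telescope : (x y z : V p) → (x ⊖ y) ⊕ (y ⊕ z) ≡ x ⊕ z
  ⊖-⊕-telescope []      []      []      = refl
  ⊖-⊕-telescope (a ∷ x) (b ∷ y) (c ∷ z) =
    cong₂ _∷_ (solve 3 (λ a b c → (a :- b) :+ (b :+ c) := a :+ c) refl a b c) (⊖-⊕-telescope x y z)

  ⊕-⊖-cancelʳ : (x y z : V p) → (x ⊕ y) ⊕ (z ⊖ y) ≡ x ⊕ z
  ⊕-⊖-cancelʳ []      []      []      = refl
  ⊕-⊖-cancelʳ (a ∷ x) (b ∷ y) (c ∷ z) =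
    cong₂ _∷_ (solve 3 (λ a b c → (a :+ b) :+ (c :- b) := a :+ c) refl a b c) (⊕-⊖-cancelʳ x y z)

  ⊖-⊕-double : (x y : V p) → (x ⊖ y) ⊕ (+ 2) · y ≡ x ⊕ y
  ⊖-⊕-double []      []      = refl
  ⊖-⊕-double (a ∷ x) (b ∷ y) =
    cong₂ _∷_ (solve 2 (λ a b → (a :- b) :+ con (+ 2) :* b := a :+ b) refl a b) (⊖-⊕-double x y)

  zeroV-⊕-zeroV : zeroV {p} ⊕ zeroV ≡ zeroV
  zeroV-⊕-zeroV {zero}  = refl
  zeroV-⊕-zeroV {suc p} = cong (+ 0 ∷_) zeroV-⊕-zeroV

  ·-⊕-zeroV : (v : V p) → (+ 1) · v ⊕ zeroV ≡ v
  ·-⊕-zeroV []      = refl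
  ·-⊕-zeroV (a ∷ v) = cong₂ _∷_ (trans (ℤ.+-identityʳ (+ 1 * a)) (ℤ.*-identityˡ a)) (·-⊕-zeroV v)

  zero-·-⊕ : (v w : V p) → (+ 0) · v ⊕ w ≡ w
  zero-·-⊕ []      []      = refl
  zero-·-⊕ (a ∷ v) (b ∷ w) = cong₂ _∷_ (trans (cong (_+ b) (ℤ.*-zeroˡ a)) (ℤ.+-identityˡ b)) (zero-·-⊕ v w)

  +-·-⊕-interchange : (a b : ℤ) (v x y : V p) → (a + b) · v ⊕ (x ⊕ y) ≡ (a · v ⊕ x) ⊕ (b · v ⊕ y)
  +-·-⊕-interchange a b []      []      []      = refl
  +-·-⊕-interchange a b (c ∷ v) (d ∷ x) (f ∷ y) =
    cong₂ _∷_ (solve 5 (λ a b c d f → (a :+ b) :* c :+ (d :+ f) := (a :* c :+ d) :+ (b :* c :+ f)) refl a b c d f)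
              (+-·-⊕-interchange a b v x y)

  e-zero : e {suc p} 0 ≡ + 1 ∷ zeroV
  e-zero = cong (+ 1 ∷_) tabulate-zero
    where
      tabulate-zero : ∀ {n} → Vec.tabulate {n = n} (λ _ → + 0) ≡ zeroV
      tabulate-zero {zero}  = refl
      tabulate-zero {suc n} = cong (+ 0 ∷_) tabulate-zero

  prefixSum : ℕ → V p → ℤ
  prefixSum zero    _        = + 0
  prefixSum (suc n) []       = + 0
  prefixSum (suc n) (a ∷ v)  = a + prefixSum n v

  prefixSum-⊕ : ∀ n (x y : V p) → prefixSum n (x ⊕ y) ≡ prefixSum n x + prefixSum n y
  prefixSum-⊕ zero    x       y       = refl
  prefixSum-⊕ (suc n) []      []      = refl
  prefixSum-⊕ (suc n) (a ∷ x) (b ∷ y) =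
    trans (cong (_+_ (a + b)) (prefixSum-⊕ n x y))
          (solve 4 (λ a b s t → (a :+ b) :+ (s :+ t) := (a :+ s) :+ (b :+ t)) refl a b (prefixSum n x) (prefixSum n y))

  prefixSum-⊖ : ∀ n (x y : V p) → prefixSum n (x ⊖ y) ≡ prefixSum n x - prefixSum n y
  prefixSum-⊖ zero    x       y       = refl
  prefixSum-⊖ (suc n) []      []      = refl
  prefixSum-⊖ (suc n) (a ∷ x) (b ∷ y) =
    trans (cong (_+_ (a - b)) (prefixSum-⊖ n x y))
          (solve 4 (λ a b s t → (a :- b) :+ (s :- t) := (a :+ s) :- (b :+ t)) refl a b (prefixSum n x) (prefixSum n y))

  prefixSum-· : ∀ n c (x : V p) → prefixSum n (c · x) ≡ c * prefixSum n x
  prefixSum-· zero    c x       = sym (ℤ.*-zeroʳ c)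
  prefixSum-· (suc n) c []      = sym (ℤ.*-zeroʳ c)
  prefixSum-· (suc n) c (a ∷ x) =
    trans (cong (_+_ (c * a)) (prefixSum-· n c x)) (sym (ℤ.*-distribˡ-+ c a (prefixSum n x)))

  prefixSum-zeroV : ∀ n → prefixSum n (zeroV {p}) ≡ + 0
  prefixSum-zeroV         zero    = refl
  prefixSum-zeroV {zero}  (suc n) = refl
  prefixSum-zeroV {suc p} (suc n) = trans (ℤ.+-identityˡ _) (prefixSum-zeroV n)

  𝟙[_<_] : ℕ → ℕ → ℤ
  𝟙[ x < n ] = + (if x <ᵇ n then 1 else 0)

  𝟙[<]-yes : ∀ {x n} → x < n → 𝟙[ x < n ] ≡ + 1
  𝟙[<]-yes {zero}  {suc n} _       = refl
  𝟙[<]-yes {suc x} {suc n} (s≤s l) = 𝟙[<]-yes {x} {n} l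

  𝟙[<]-no : ∀ {x n} → n ≤ x → 𝟙[ x < n ] ≡ + 0
  𝟙[<]-no {x}     {zero}  _       = refl
  𝟙[<]-no {suc x} {suc n} (s≤s l) = 𝟙[<]-no {x} {n} l

  prefixSum-e : ∀ n x → x < p → prefixSum n (e {p} x) ≡ 𝟙[ x < n ]
  prefixSum-e         zero    x       _       = refl
  prefixSum-e {suc p} (suc n) zero    _       = trans (cong (prefixSum (suc n)) (e-zero {p})) (cong (_+_ (+ 1)) (prefixSum-zeroV n))
  prefixSum-e {suc p} (suc n) (suc x) (s≤s l) = trans (ℤ.+-identityˡ _) (prefixSum-e n x l)

  norm : V p → ℤ
  norm v = ⟨ v , v ⟩

  norm-zeroV : norm (zeroV {p}) ≡ + 0
  norm-zeroV {zero}  = refl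
  norm-zeroV {suc p} = trans (ℤ.+-identityˡ _) (norm-zeroV {p})

  norm-zeroV⊖e : ∀ y → y < p → norm (zeroV ⊖ e {p} y) ≡ + 1
  norm-zeroV⊖e {suc p} zero    _       = begin
    norm (zeroV ⊖ e {suc p} 0)  ≡⟨ cong (λ v → norm (zeroV ⊖ v)) (e-zero {p}) ⟩
    + 1 + norm (zeroV {p} ⊖ zeroV) ≡⟨ cong (λ v → + 1 + norm v) (⊖-self (zeroV {p})) ⟩
    + 1 + norm (zeroV {p})      ≡⟨ cong (_+_ (+ 1)) (norm-zeroV {p}) ⟩
    + 1                         ∎
    where open ≡-Reasoning
  norm-zeroV⊖e {suc p} (suc y) (s≤s l) = trans (ℤ.+-identityˡ _) (norm-zeroV⊖e y l)

  norm-zeroV⊕e : ∀ y → y < p → norm (zeroV ⊕ e {p} y) ≡ + 1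
  norm-zeroV⊕e {suc p} zero    _       = begin
    norm (zeroV ⊕ e {suc p} 0)  ≡⟨ cong (λ v → norm (zeroV ⊕ v)) (e-zero {p}) ⟩
    + 1 + norm (zeroV {p} ⊕ zeroV) ≡⟨ cong (λ v → + 1 + norm v) (zeroV-⊕-zeroV {p}) ⟩
    + 1 + norm (zeroV {p})      ≡⟨ cong (_+_ (+ 1)) (norm-zeroV {p}) ⟩
    + 1                         ∎
    where open ≡-Reasoning
  norm-zeroV⊕e {suc p} (suc y) (s≤s l) = trans (ℤ.+-identityˡ _) (norm-zeroV⊕e y l)

  norm-e⊖e : ∀ x y → x < y → y < p → norm (e {p} x ⊖ e y) ≡ + 2
  norm-e⊖e {suc p} zero    (suc y) _        (s≤s l) =
    trans (cong (λ v → norm (v ⊖ e (suc y))) (e-zero {p})) (cong (_+_ (+ 1)) (norm-zeroV⊖e y l))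
  norm-e⊖e {suc p} (suc x) (suc y) (s≤s xy) (s≤s l) = trans (ℤ.+-identityˡ _) (norm-e⊖e x y xy l)

  norm-e⊕e : ∀ x y → x < y → y < p → norm (e {p} x ⊕ e y) ≡ + 2
  norm-e⊕e {suc p} zero    (suc y) _        (s≤s l) =
    trans (cong (λ v → norm (v ⊕ e (suc y))) (e-zero {p})) (cong (_+_ (+ 1)) (norm-zeroV⊕e y l))
  norm-e⊕e {suc p} (suc x) (suc y) (s≤s xy) (s≤s l) = trans (ℤ.+-identityˡ _) (norm-e⊕e x y xy l)

  norm-2e : ∀ x → x < p → norm ((+ 2) · e {p} x) ≡ + 4
  norm-2e {suc p} zero    _       = begin
    norm ((+ 2) · e {suc p} 0)     ≡⟨ cong (λ v → norm ((+ 2) · v)) (e-zero {p}) ⟩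
    + 4 + norm ((+ 2) · zeroV {p}) ≡⟨ cong (λ v → + 4 + norm v) (Vec.map-replicate (_*_ (+ 2)) (+ 0) p) ⟩
    + 4 + norm (zeroV {p})         ≡⟨ cong (_+_ (+ 4)) (norm-zeroV {p}) ⟩
    + 4                            ∎
    where open ≡-Reasoning
  norm-2e {suc p} (suc x) (s≤s l) = trans (ℤ.+-identityˡ _) (norm-2e x l)

module RootForms where

  open import Defs
  open ListFacts
  open Vectors
  open import Data.Nat as ℕ using (ℕ; zero; suc; _<_; _≤_; s≤s; z≤n; _<ᵇ_; _≡ᵇ_)
  import Data.Nat.Properties as ℕ
  open import Data.Integer as ℤ using (ℤ; +_; _+_; _*_; _-_)
  import Data.Integer.Properties as ℤ
  open import Data.Fin as Fin using (Fin; toℕ; fromℕ<)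
  import Data.Fin.Properties as Fin
  open import Data.Bool using (true; false; if_then_else_; T)
  open import Data.List as List using (List; []; _∷_; _++_; concatMap; allFin)
  open import Data.List.Properties using (map-concatMap; concatMap-cong; map-++)
  open import Data.List.Membership.Propositional using (_∈_; find; lose)
  open import Data.List.Membership.Propositional.Properties
    using (∈-allFin; ∈-++⁻; ∈-++⁺ˡ; ∈-++⁺ʳ; ∈-concatMap⁻; ∈-concatMap⁺; ∈-map⁻; ∈-map⁺)
  open import Data.List.Relation.Unary.Any using (here; there)
  open import Data.List.Relation.Unary.All using ([]; _∷_)
  open import Data.List.Relation.Unary.AllPairs using ([]; _∷_)
  open import Data.List.Relation.Unary.Unique.Propositional using (Unique)
  import Data.List.Relation.Unary.Unique.Propositional.Properties as Unique
  open import Data.Product using (∃; _×_; _,_; proj₁; proj₂)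
  open import Data.Sum using (_⊎_; inj₁; inj₂)
  open import Data.Empty using (⊥; ⊥-elim)
  open import Relation.Nullary using (¬_)
  open import Relation.Binary.Definitions using (tri<; tri≈; tri>)
  open import Relation.Binary.PropositionalEquality

  private variable p : ℕ

  data RootForm : Set where
    minus plus : ℕ → ℕ → RootForm
    double     : ℕ → RootForm

  vec : RootForm → V p
  vec (minus x y) = e x ⊖ e y
  vec (plus x y)  = e x ⊕ e y
  vec (double x)  = (+ 2) · e x

  Valid : ℕ → RootForm → Set
  Valid p (minus x y) = x < y × y < p
  Valid p (plus x y)  = x < y × y < p
  Valid p (double x)  = x < p

  lead : RootForm → ℕ
  lead (minus x _) = x
  lead (plus x _)  = x
  lead (double x)  = x

  prefixSumᶠ : RootForm → ℕ → ℤ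
  prefixSumᶠ (minus x y) n = 𝟙[ x < n ] - 𝟙[ y < n ]
  prefixSumᶠ (plus x y)  n = 𝟙[ x < n ] + 𝟙[ y < n ]
  prefixSumᶠ (double x)  n = + 2 * 𝟙[ x < n ]

  prefixSum-vec : ∀ n F → Valid p F → prefixSum n (vec {p} F) ≡ prefixSumᶠ F n
  prefixSum-vec {p} n (minus x y) (x<y , y<p) =
    trans (prefixSum-⊖ n (e {p} x) (e y)) (cong₂ _-_ (prefixSum-e n x (ℕ.<-trans x<y y<p)) (prefixSum-e n y y<p))
  prefixSum-vec {p} n (plus x y)  (x<y , y<p) =
    trans (prefixSum-⊕ n (e {p} x) (e y)) (cong₂ _+_ (prefixSum-e n x (ℕ.<-trans x<y y<p)) (prefixSum-e n y y<p))
  prefixSum-vec {p} n (double x)  x<p =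
    trans (prefixSum-· n (+ 2) (e {p} x)) (cong (+ 2 *_) (prefixSum-e n x x<p))

  prefixSumᶠ-nonneg : ∀ n F → Valid p F → ∃ λ k → prefixSumᶠ F n ≡ + k
  prefixSumᶠ-nonneg n (minus x y) (x<y , _) with ℕ.<-≤-connex y n
  ... | inj₁ y<n = 0 , cong₂ _-_ (𝟙[<]-yes (ℕ.<-trans x<y y<n)) (𝟙[<]-yes y<n)
  ... | inj₂ n≤y = _ , trans (cong (𝟙[ x < n ] -_) (𝟙[<]-no n≤y)) (ℤ.+-identityʳ 𝟙[ x < n ])
  prefixSumᶠ-nonneg n (plus x y)  _ = _ , refl
  prefixSumᶠ-nonneg n (double x)  _ = _ , sym (ℤ.pos-* 2 (if x <ᵇ n then 1 else 0))

  prefixSumᶠ-below-lead : ∀ n F → Valid p F → n ≤ lead F → prefixSumᶠ F n ≡ + 0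
  prefixSumᶠ-below-lead n (minus x y) (x<y , _) n≤x = cong₂ _-_ (𝟙[<]-no n≤x) (𝟙[<]-no (ℕ.≤-trans n≤x (ℕ.<⇒≤ x<y)))
  prefixSumᶠ-below-lead n (plus x y)  (x<y , _) n≤x = cong₂ _+_ (𝟙[<]-no n≤x) (𝟙[<]-no (ℕ.≤-trans n≤x (ℕ.<⇒≤ x<y)))
  prefixSumᶠ-below-lead n (double x)  _         n≤x = cong (+ 2 *_) (𝟙[<]-no n≤x)

  module _ {x y n : ℕ} where

    minus-inside : x < n → n ≤ y → prefixSumᶠ (minus x y) n ≡ + 1
    minus-inside x<n n≤y = cong₂ _-_ (𝟙[<]-yes x<n) (𝟙[<]-no n≤y)

    plus-inside : x < n → n ≤ y → prefixSumᶠ (plus x y) n ≡ + 1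
    plus-inside x<n n≤y = cong₂ _+_ (𝟙[<]-yes x<n) (𝟙[<]-no n≤y)

    minus-beyond : x < y → y < n → prefixSumᶠ (minus x y) n ≡ + 0
    minus-beyond x<y y<n = cong₂ _-_ (𝟙[<]-yes (ℕ.<-trans x<y y<n)) (𝟙[<]-yes y<n)

    plus-beyond : x < y → y < n → prefixSumᶠ (plus x y) n ≡ + 2
    plus-beyond x<y y<n = cong₂ _+_ (𝟙[<]-yes (ℕ.<-trans x<y y<n)) (𝟙[<]-yes y<n)

  double-beyond : ∀ {x n} → x < n → prefixSumᶠ (double x) n ≡ + 2
  double-beyond x<n = cong (+ 2 *_) (𝟙[<]-yes x<n)

  prefixSumᶠ-past-lead : ∀ F → Valid p F → + 0 ℤ.< prefixSumᶠ F (suc (lead F))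
  prefixSumᶠ-past-lead (minus x y) (x<y , _) = subst (+ 0 ℤ.<_) (sym (minus-inside {x} ℕ.≤-refl x<y)) (ℤ.+<+ (s≤s z≤n))
  prefixSumᶠ-past-lead (plus x y)  (x<y , _) = subst (+ 0 ℤ.<_) (sym (plus-inside {x} ℕ.≤-refl x<y)) (ℤ.+<+ (s≤s z≤n))
  prefixSumᶠ-past-lead (double x)  _         = subst (+ 0 ℤ.<_) (sym (double-beyond {x} ℕ.≤-refl)) (ℤ.+<+ (s≤s z≤n))

  private
    differ-at : ∀ {F G} n {u v} → (∀ n → prefixSumᶠ F n ≡ prefixSumᶠ G n) →
      prefixSumᶠ F n ≡ u → prefixSumᶠ G n ≡ v → u ≢ v → F ≡ G
    differ-at n same Fn Gn u≢v = ⊥-elim (u≢v (trans (sym Fn) (trans (same n) Gn)))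

  -- Roots with equal prefix sums share their lead (compare just past the smaller one), then their
  -- shape (compare just past the lead, and at n = p) and their partner (just past the smaller one).
  prefixSumᶠ-injective : ∀ F G → Valid p F → Valid p G → (∀ n → prefixSumᶠ F n ≡ prefixSumᶠ G n) → F ≡ G
  prefixSumᶠ-injective F G vF vG same with ℕ.<-cmp (lead F) (lead G)
  ... | tri< F<G _ _ = ⊥-elim (ℤ.<⇒≢ (prefixSumᶠ-past-lead F vF) (sym (trans (same _) (prefixSumᶠ-below-lead _ G vG F<G))))
  ... | tri> _ _ G<F = ⊥-elim (ℤ.<⇒≢ (prefixSumᶠ-past-lead G vG) (sym (trans (sym (same _)) (prefixSumᶠ-below-lead _ F vF G<F))))
  prefixSumᶠ-injective (minus x y) (minus x y′) (x<y , _) (x<y′ , _) same | tri≈ _ refl _ with ℕ.<-cmp y y′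
  ... | tri< y<y′ _ _ = differ-at (suc y) same (minus-beyond {x} x<y ℕ.≤-refl) (minus-inside {x} (s≤s (ℕ.<⇒≤ x<y)) y<y′) λ ()
  ... | tri≈ _ refl _ = refl
  ... | tri> _ _ y′<y = differ-at (suc y′) same (minus-inside {x} (s≤s (ℕ.<⇒≤ x<y′)) y′<y) (minus-beyond {x} x<y′ ℕ.≤-refl) λ ()
  prefixSumᶠ-injective (plus x y) (plus x y′) (x<y , _) (x<y′ , _) same | tri≈ _ refl _ with ℕ.<-cmp y y′
  ... | tri< y<y′ _ _ = differ-at (suc y) same (plus-beyond {x} x<y ℕ.≤-refl) (plus-inside {x} (s≤s (ℕ.<⇒≤ x<y)) y<y′) λ ()
  ... | tri≈ _ refl _ = refl
  ... | tri> _ _ y′<y = differ-at (suc y′) same (plus-inside {x} (s≤s (ℕ.<⇒≤ x<y′)) y′<y) (plus-beyond {x} x<y′ ℕ.≤-refl) λ ()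
  prefixSumᶠ-injective {p} (minus x y) (plus x y′) (x<y , y<p) (x<y′ , y′<p) same | tri≈ _ refl _ =
    differ-at p same (minus-beyond {x} x<y y<p) (plus-beyond {x} x<y′ y′<p) λ ()
  prefixSumᶠ-injective {p} (plus x y) (minus x y′) (x<y , y<p) (x<y′ , y′<p) same | tri≈ _ refl _ =
    differ-at p same (plus-beyond {x} x<y y<p) (minus-beyond {x} x<y′ y′<p) λ ()
  prefixSumᶠ-injective (double x) (minus x y′) _ (x<y′ , _) same | tri≈ _ refl _ =
    differ-at (suc x) same (double-beyond {x} ℕ.≤-refl) (minus-inside {x} ℕ.≤-refl x<y′) λ ()
  prefixSumᶠ-injective (double x) (plus x y′) _ (x<y′ , _) same | tri≈ _ refl _ =
    differ-at (suc x) same (double-beyond {x} ℕ.≤-refl) (plus-inside {x} ℕ.≤-refl x<y′) λ ()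
  prefixSumᶠ-injective (minus x y) (double x) (x<y , _) _ same | tri≈ _ refl _ =
    differ-at (suc x) same (minus-inside {x} ℕ.≤-refl x<y) (double-beyond {x} ℕ.≤-refl) λ ()
  prefixSumᶠ-injective (plus x y) (double x) (x<y , _) _ same | tri≈ _ refl _ =
    differ-at (suc x) same (plus-inside {x} ℕ.≤-refl x<y) (double-beyond {x} ℕ.≤-refl) λ ()
  prefixSumᶠ-injective (double x) (double x) _ _ _ | tri≈ _ refl _ = refl

  vec-injective : ∀ F G → Valid p F → Valid p G → vec {p} F ≡ vec G → F ≡ G
  vec-injective F G vF vG F≡G = prefixSumᶠ-injective F G vF vG λ n →
    trans (sym (prefixSum-vec n F vF)) (trans (cong (prefixSum n) F≡G) (prefixSum-vec n G vG))

  pairForms : Fin p → Fin p → List RootForm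
  pairForms i j = if toℕ i <ᵇ toℕ j then minus (toℕ i) (toℕ j) ∷ plus (toℕ i) (toℕ j) ∷ [] else []

  blockForms : ∀ p → Fin p → List RootForm
  blockForms p i = concatMap (pairForms i) (allFin p) ++ double (toℕ i) ∷ []

  rootForms : ℕ → List RootForm
  rootForms p = concatMap (blockForms p) (allFin p)

  posRoots≡map-vec : ∀ p → posRoots p ≡ List.map vec (rootForms p)
  posRoots≡map-vec p = sym (trans (map-concatMap vec (blockForms p) (allFin p)) (concatMap-cong block (allFin p)))
    where
      pair : ∀ i j → List.map vec (pairForms i j) ≡
        (if toℕ i <ᵇ toℕ j then (e (toℕ i) ⊖ e (toℕ j)) ∷ (e (toℕ i) ⊕ e (toℕ j)) ∷ [] else [])
      pair i j with toℕ i <ᵇ toℕ j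
      ... | true  = refl
      ... | false = refl
      block : ∀ i → List.map vec (blockForms p i) ≡
        concatMap (λ j → if toℕ i <ᵇ toℕ j then (e (toℕ i) ⊖ e (toℕ j)) ∷ (e (toℕ i) ⊕ e (toℕ j)) ∷ [] else []) (allFin p)
          ++ (+ 2) · e (toℕ i) ∷ []
      block i = trans (map-++ vec (concatMap (pairForms i) (allFin p)) _)
        (cong (_++ (+ 2) · e (toℕ i) ∷ []) (trans (map-concatMap vec (pairForms i) (allFin p)) (concatMap-cong (pair i) (allFin p))))

  <ᵇ⇒< : ∀ {m n} → (m <ᵇ n) ≡ true → m < n
  <ᵇ⇒< {zero}  {suc n} _  = s≤s z≤n
  <ᵇ⇒< {suc m} {suc n} eq = s≤s (<ᵇ⇒< eq)

  <⇒<ᵇ : ∀ {m n} → m < n → (m <ᵇ n) ≡ true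
  <⇒<ᵇ {zero}  {suc n} _       = refl
  <⇒<ᵇ {suc m} {suc n} (s≤s l) = <⇒<ᵇ l

  ≤⇒≮ᵇ : ∀ {m n} → n ≤ m → (m <ᵇ n) ≡ false
  ≤⇒≮ᵇ {m}     {zero}  _       = refl
  ≤⇒≮ᵇ {suc m} {suc n} (s≤s l) = ≤⇒≮ᵇ l

  ∈-pairForms⁻ : ∀ {F} (i j : Fin p) → F ∈ pairForms i j →
    toℕ i < toℕ j × (F ≡ minus (toℕ i) (toℕ j) ⊎ F ≡ plus (toℕ i) (toℕ j))
  ∈-pairForms⁻ i j F∈ with toℕ i <ᵇ toℕ j in i<j
  ∈-pairForms⁻ i j (here refl)         | true = <ᵇ⇒< i<j , inj₁ refl
  ∈-pairForms⁻ i j (there (here refl)) | true = <ᵇ⇒< i<j , inj₂ refl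

  ∈-blockForms⁻ : ∀ {F} (i : Fin p) → F ∈ blockForms p i → Valid p F × lead F ≡ toℕ i
  ∈-blockForms⁻ {p} i F∈ with ∈-++⁻ (concatMap (pairForms i) (allFin p)) F∈
  ... | inj₂ (here refl) = Fin.toℕ<n i , refl
  ... | inj₁ F∈pairs with j , _ , F∈ij ← find (∈-concatMap⁻ (pairForms i) {xs = allFin p} F∈pairs)
                      with ∈-pairForms⁻ i j F∈ij
  ...   | i<j , inj₁ refl = (i<j , Fin.toℕ<n j) , refl
  ...   | i<j , inj₂ refl = (i<j , Fin.toℕ<n j) , refl

  ∈-rootForms⁻ : ∀ {F} → F ∈ rootForms p → Valid p F
  ∈-rootForms⁻ {p} F∈ with i , _ , F∈i ← find (∈-concatMap⁻ (blockForms p) {xs = allFin p} F∈) =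
    proj₁ (∈-blockForms⁻ i F∈i)

  ∈-pairForms⁺ : (i j : Fin p) → toℕ i < toℕ j →
    minus (toℕ i) (toℕ j) ∈ pairForms i j × plus (toℕ i) (toℕ j) ∈ pairForms i j
  ∈-pairForms⁺ i j i<j rewrite <⇒<ᵇ i<j = here refl , there (here refl)

  ∈-blockForms⁺ : ∀ F (i : Fin p) → Valid p F → lead F ≡ toℕ i → F ∈ blockForms p i
  ∈-blockForms⁺ {p} (double x) i _ refl = ∈-++⁺ʳ (concatMap (pairForms i) (allFin p)) (here refl)
  ∈-blockForms⁺ {p} (minus x y) i (x<y , y<p) refl =
    ∈-++⁺ˡ (∈-concatMap⁺ (pairForms i) (lose (∈-allFin j) (subst (λ t → minus (toℕ i) t ∈ pairForms i j) toℕj≡y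
      (proj₁ (∈-pairForms⁺ i j (subst (toℕ i <_) (sym toℕj≡y) x<y))))))
    where j = fromℕ< y<p; toℕj≡y = Fin.toℕ-fromℕ< y<p
  ∈-blockForms⁺ {p} (plus x y) i (x<y , y<p) refl =
    ∈-++⁺ˡ (∈-concatMap⁺ (pairForms i) (lose (∈-allFin j) (subst (λ t → plus (toℕ i) t ∈ pairForms i j) toℕj≡y
      (proj₂ (∈-pairForms⁺ i j (subst (toℕ i <_) (sym toℕj≡y) x<y))))))
    where j = fromℕ< y<p; toℕj≡y = Fin.toℕ-fromℕ< y<p

  lead<p : ∀ F → Valid p F → lead F < p
  lead<p (minus x y) (x<y , y<p) = ℕ.<-trans x<y y<p
  lead<p (plus x y)  (x<y , y<p) = ℕ.<-trans x<y y<p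
  lead<p (double x)  x<p         = x<p

  ∈-rootForms⁺ : ∀ F → Valid p F → F ∈ rootForms p
  ∈-rootForms⁺ {p} F vF = ∈-concatMap⁺ (blockForms p) (lose (∈-allFin i) (∈-blockForms⁺ F i vF (sym (Fin.toℕ-fromℕ< (lead<p F vF)))))
    where i = fromℕ< (lead<p F vF)

  partner : RootForm → ℕ
  partner (minus _ y) = y
  partner (plus _ y)  = y
  partner (double x)  = x

  rootForms-unique : ∀ p → Unique (rootForms p)
  rootForms-unique p = concatMap-unique (blockForms p) (Unique.allFin⁺ p) block-unique
    λ {i} {i′} F∈i F∈i′ → Fin.toℕ-injective (trans (sym (proj₂ (∈-blockForms⁻ i F∈i))) (proj₂ (∈-blockForms⁻ i′ F∈i′)))
    where
      pair-unique : ∀ i j → Unique (pairForms i j)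
      pair-unique i j = if-unique (toℕ i <ᵇ toℕ j)
        where
          if-unique : ∀ b → Unique (if b then minus (toℕ i) (toℕ j) ∷ plus (toℕ i) (toℕ j) ∷ [] else [])
          if-unique true  = ((λ ()) ∷ []) ∷ [] ∷ []
          if-unique false = []
      pair-partner : ∀ {F} i j → F ∈ pairForms i j → partner F ≡ toℕ j
      pair-partner i j F∈ with ∈-pairForms⁻ i j F∈
      ... | _ , inj₁ F≡ = cong partner F≡
      ... | _ , inj₂ F≡ = cong partner F≡
      pair-not-double : ∀ {x} i j → double x ∈ pairForms i j → ⊥
      pair-not-double i j F∈ with ∈-pairForms⁻ i j F∈
      ... | _ , inj₁ ()
      ... | _ , inj₂ ()
      block-unique : ∀ i → Unique (blockForms p i)
      block-unique i = Unique.++⁺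
        (concatMap-unique (pairForms i) (Unique.allFin⁺ p) (pair-unique i)
          λ {j} {j′} F∈j F∈j′ → Fin.toℕ-injective (trans (sym (pair-partner i j F∈j)) (pair-partner i j′ F∈j′)))
        ([] ∷ [])
        λ { (F∈pairs , here refl) → let j , _ , F∈j = find (∈-concatMap⁻ (pairForms i) {xs = allFin p} F∈pairs)
                                    in pair-not-double i j F∈j }

  posRoots-unique : ∀ p → Unique (posRoots p)
  posRoots-unique p rewrite posRoots≡map-vec p =
    map-unique-on vec (λ F∈ G∈ → vec-injective _ _ (∈-rootForms⁻ F∈) (∈-rootForms⁻ G∈)) (rootForms-unique p)

  ∈-posRoots⁻ : ∀ {v} → v ∈ posRoots p → ∃ λ F → Valid p F × v ≡ vec F
  ∈-posRoots⁻ {p} v∈ with F , F∈ , refl ← ∈-map⁻ vec (subst (_ ∈_) (posRoots≡map-vec p) v∈) = F , ∈-rootForms⁻ F∈ , refl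

  ∈-posRoots⁺ : ∀ F → Valid p F → vec F ∈ posRoots p
  ∈-posRoots⁺ {p} F vF = subst (vec F ∈_) (sym (posRoots≡map-vec p)) (∈-map⁺ vec (∈-rootForms⁺ F vF))

  simpleForm : Fin p → RootForm
  simpleForm {p} i = if suc (toℕ i) ≡ᵇ p then double (toℕ i) else minus (toℕ i) (suc (toℕ i))

  α≡vec-simpleForm : (i : Fin p) → α i ≡ vec (simpleForm i)
  α≡vec-simpleForm {p} i = by-cases (suc (toℕ i) ≡ᵇ p)
    where
      by-cases : ∀ b → (if b then (+ 2) · e (toℕ i) else e (toℕ i) ⊖ e (suc (toℕ i)))
                       ≡ vec {p} (if b then double (toℕ i) else minus (toℕ i) (suc (toℕ i)))
      by-cases true  = refl
      by-cases false = refl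

  simpleForm-cases : (i : Fin p) →
    simpleForm i ≡ double (toℕ i) × suc (toℕ i) ≡ p ⊎ simpleForm i ≡ minus (toℕ i) (suc (toℕ i)) × suc (toℕ i) < p
  simpleForm-cases {p} i = by-cases (suc (toℕ i) ≡ᵇ p) refl
    where
      by-cases : ∀ b → (suc (toℕ i) ≡ᵇ p) ≡ b →
        (if b then double (toℕ i) else minus (toℕ i) (suc (toℕ i))) ≡ double (toℕ i) × suc (toℕ i) ≡ p
        ⊎ (if b then double (toℕ i) else minus (toℕ i) (suc (toℕ i))) ≡ minus (toℕ i) (suc (toℕ i)) × suc (toℕ i) < p
      by-cases true  eq = inj₁ (refl , ℕ.≡ᵇ⇒≡ _ _ (subst T (sym eq) _))
      by-cases false eq = inj₂ (refl , ℕ.≤∧≢⇒< (Fin.toℕ<n i) λ i+1≡p → subst T eq (ℕ.≡⇒≡ᵇ _ _ i+1≡p))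

  simpleForm-valid : (i : Fin p) → Valid p (simpleForm i)
  simpleForm-valid i with simpleForm-cases i
  ... | inj₁ (sf≡double , _)    = subst (Valid _) (sym sf≡double) (Fin.toℕ<n i)
  ... | inj₂ (sf≡minus , i+1<p) = subst (Valid _) (sym sf≡minus) (ℕ.n<1+n _ , i+1<p)

  α-short : (i : Fin p) → suc (toℕ i) < p → α i ≡ vec (minus (toℕ i) (suc (toℕ i)))
  α-short i i+1<p with simpleForm-cases i
  ... | inj₁ (_ , i+1≡p)    = ⊥-elim (ℕ.<-irrefl i+1≡p i+1<p)
  ... | inj₂ (sf≡minus , _) = trans (α≡vec-simpleForm i) (cong vec sf≡minus)

  α-long : (i : Fin p) → suc (toℕ i) ≡ p → α i ≡ vec (double (toℕ i))
  α-long i i+1≡p with simpleForm-cases i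
  ... | inj₁ (sf≡double , _) = trans (α≡vec-simpleForm i) (cong vec sf≡double)
  ... | inj₂ (_ , i+1<p)     = ⊥-elim (ℕ.<-irrefl i+1≡p i+1<p)

  minus-short : ∀ {x y} → x < y → y < p → IsShort (vec {p} (minus x y))
  minus-short x<y y<p = norm-e⊖e _ _ x<y y<p

  plus-short : ∀ {x y} → x < y → y < p → IsShort (vec {p} (plus x y))
  plus-short x<y y<p = norm-e⊕e _ _ x<y y<p

  double-long : ∀ {x} → x < p → ¬ IsShort (vec {p} (double x))
  double-long {x = x} x<p short with () ← trans (sym (norm-2e x x<p)) short

  vec-short : ∀ F → Valid p F → (∀ x → F ≢ double x) → IsShort (vec {p} F)
  vec-short (minus x y) (x<y , y<p) _ = minus-short x<y y<p
  vec-short (plus x y)  (x<y , y<p) _ = plus-short x<y y<p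
  vec-short (double x)  _           F≢double = ⊥-elim (F≢double x refl)

  InΠs⇒adjacent : ∀ F → Valid p F → InΠs (vec {p} F) → ∃ λ x → F ≡ minus x (suc x)
  InΠs⇒adjacent F vF (i , F≡αi , short) with simpleForm-cases i
  ... | inj₁ (sf≡double , _) =
    ⊥-elim (double-long (Fin.toℕ<n i) (subst IsShort (trans (α≡vec-simpleForm i) (cong vec sf≡double)) short))
  ... | inj₂ (sf≡minus , i+1<p) = toℕ i ,
    vec-injective F _ vF (ℕ.n<1+n _ , i+1<p) (trans F≡αi (trans (α≡vec-simpleForm i) (cong vec sf≡minus)))

  adjacent⇒InΠs : ∀ {x} → suc x < p → InΠs (vec {p} (minus x (suc x)))
  adjacent⇒InΠs {p} {x} x+1<p = i , sym αi≡ , subst IsShort (sym αi≡) (minus-short (ℕ.n<1+n x) x+1<p)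
    where
      x<p = ℕ.<-trans (ℕ.n<1+n x) x+1<p
      i = fromℕ< x<p
      toℕi≡x = Fin.toℕ-fromℕ< x<p
      αi≡ : α i ≡ vec (minus x (suc x))
      αi≡ = trans (α-short i (subst (λ t → suc t < p) (sym toℕi≡x) x+1<p)) (cong (λ t → vec (minus t (suc t))) toℕi≡x)

module Dominance where

  open import Defs
  open Vectors
  open RootForms
  open import Data.Nat as ℕ using (ℕ; z≤n)
  open import Data.Integer as ℤ using (ℤ; +_; _+_; _*_; _-_)
  import Data.Integer.Properties as ℤ
  open import Data.Fin as Fin using (Fin)
  open import Data.Bool using (if_then_else_)
  open import Data.List as List using (List; []; _∷_; allFin)
  open import Data.List.Membership.Propositional using (_∈_)
  open import Data.List.Membership.Propositional.Properties using (∈-allFin)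
  open import Data.List.Relation.Unary.Any using (here; there)
  open import Data.List.Relation.Unary.All as All using (All; []; _∷_)
  open import Data.List.Relation.Unary.AllPairs using ([]; _∷_)
  open import Data.List.Relation.Unary.Unique.Propositional using (Unique)
  import Data.List.Relation.Unary.Unique.Propositional.Properties as Unique
  open import Data.Product using (∃; _,_)
  open import Data.Empty using (⊥-elim)
  open import Relation.Nullary using (does; yes; no)
  open import Relation.Binary.PropositionalEquality

  private variable p : ℕ

  combination : (Fin p → ℕ) → List (Fin p) → V p
  combination c = List.foldr (λ i acc → (+ c i) · α i ⊕ acc) zeroV

  combination-+ : ∀ (c d : Fin p → ℕ) L →
    combination (λ i → c i ℕ.+ d i) L ≡ combination c L ⊕ combination d L
  combination-+ c d []      = sym zeroV-⊕-zeroV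
  combination-+ c d (i ∷ L) = begin
    (+ (c i ℕ.+ d i)) · α i ⊕ combination (λ i → c i ℕ.+ d i) L
      ≡⟨ cong₂ (λ a v → a · α i ⊕ v) (ℤ.pos-+ (c i) (d i)) (combination-+ c d L) ⟩
    (+ c i + + d i) · α i ⊕ (combination c L ⊕ combination d L)
      ≡⟨ +-·-⊕-interchange (+ c i) (+ d i) (α i) _ _ ⟩
    ((+ c i) · α i ⊕ combination c L) ⊕ ((+ d i) · α i ⊕ combination d L) ∎
    where open ≡-Reasoning

  combination-vanishing : ∀ (c : Fin p → ℕ) L → All (λ i → c i ≡ 0) L → combination c L ≡ zeroV
  combination-vanishing c []      []          = refl
  combination-vanishing c (i ∷ L) (ci≡0 ∷ c0) =
    trans (cong (λ n → (+ n) · α i ⊕ combination c L) ci≡0)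
          (trans (zero-·-⊕ (α i) _) (combination-vanishing c L c0))

  δ : Fin p → Fin p → ℕ
  δ l i = if does (i Fin.≟ l) then 1 else 0

  combination-δ : ∀ (l : Fin p) L → Unique L → l ∈ L → combination (δ l) L ≡ α l
  combination-δ l (i ∷ L) (l∉L ∷ _) (here refl) with l Fin.≟ l
  ... | no l≢l = ⊥-elim (l≢l refl)
  ... | yes _  = trans (cong ((+ 1) · α l ⊕_) (combination-vanishing (δ l) L (All.map δl≡0 l∉L))) (·-⊕-zeroV (α l))
    where
      δl≡0 : ∀ {j} → l ≢ j → δ l j ≡ 0
      δl≡0 {j} l≢j with j Fin.≟ l
      ... | yes j≡l = ⊥-elim (l≢j (sym j≡l))
      ... | no _    = refl
  combination-δ l (i ∷ L) (i∉L ∷ u) (there l∈L) with i Fin.≟ l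
  ... | yes refl = ⊥-elim (All.lookup i∉L l∈L refl)
  ... | no _     = trans (zero-·-⊕ (α i) _) (combination-δ l L u l∈L)

  ≼-refl : (v : V p) → v ≼ v
  ≼-refl {p} v = (λ _ → 0) , trans (⊖-self v) (sym (combination-vanishing _ (allFin p) (All.tabulate λ _ → refl)))

  ≼-trans : {u v w : V p} → u ≼ v → v ≼ w → u ≼ w
  ≼-trans {p} {u} {v} {w} (c , v-u) (d , w-v) = (λ i → d i ℕ.+ c i) , (begin
    w ⊖ u               ≡⟨ sym (⊖-telescope w v u) ⟩
    (w ⊖ v) ⊕ (v ⊖ u)   ≡⟨ cong₂ _⊕_ w-v v-u ⟩
    combo d ⊕ combo c   ≡⟨ sym (combination-+ d c (allFin p)) ⟩
    combo (λ i → d i ℕ.+ c i) ∎)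
    where open ≡-Reasoning

  ≼-step : ∀ {v w : V p} l → v ⊕ α l ≡ w → v ≼ w
  ≼-step {p} {v} l refl = δ l , trans (⊕-⊖-cancelˡ v (α l)) (sym (combination-δ l (allFin p) (Unique.allFin⁺ p) (∈-allFin l)))

  prefixSum-combination : ∀ n (c : Fin p → ℕ) L → ∃ λ k → prefixSum n (combination c L) ≡ + k
  prefixSum-combination n c []      = 0 , prefixSum-zeroV n
  prefixSum-combination n c (i ∷ L)
    with s , αi-sum ← prefixSumᶠ-nonneg n (simpleForm i) (simpleForm-valid i)
       | t , rest   ← prefixSum-combination n c L = c i ℕ.* s ℕ.+ t , (begin
    prefixSum n ((+ c i) · α i ⊕ combination c L)            ≡⟨ prefixSum-⊕ n _ _ ⟩
    prefixSum n ((+ c i) · α i) + prefixSum n (combination c L) ≡⟨ cong₂ _+_ (prefixSum-· n (+ c i) (α i)) rest ⟩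
    + c i * prefixSum n (α i) + + t                          ≡⟨ cong (λ a → + c i * a + + t) αi-sum′ ⟩
    + c i * + s + + t                                        ≡⟨ cong (_+ + t) (sym (ℤ.pos-* (c i) s)) ⟩
    + (c i ℕ.* s ℕ.+ t)                                      ∎)
    where
      open ≡-Reasoning
      αi-sum′ : prefixSum n (α i) ≡ + s
      αi-sum′ = trans (cong (prefixSum n) (α≡vec-simpleForm i)) (trans (prefixSum-vec n _ (simpleForm-valid i)) αi-sum)

  ≼⇒prefixSum-≤ : ∀ {v w : V p} n → v ≼ w → prefixSum n v ℤ.≤ prefixSum n w
  ≼⇒prefixSum-≤ {p} {v} {w} n (c , w-v) with k , sum ← prefixSum-combination n c (allFin p) =
    ℤ.0≤i-j⇒j≤i (subst (ℤ.0ℤ ℤ.≤_) (sym (trans (sym (prefixSum-⊖ n w v)) (trans (cong (prefixSum n) w-v) sum))) (ℤ.+≤+ z≤n))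

module RegionChains (r : ℕ) where

  open ListFacts
  open import Data.Nat as ℕ using (ℕ; zero; suc; _+_; _∸_; _⊓_; _≤_; _<_; s≤s)
  import Data.Nat.Properties as ℕ
  open import Data.List as List using (List; []; _∷_; _++_; concatMap; applyDownFrom; downFrom; length)
  open import Data.Nat.ListAction using (sum)
  open import Data.List.Properties using (length-++; length-map; ∷-injective)
  open import Data.List.Membership.Propositional using (_∈_; find; lose)
  open import Data.List.Membership.Propositional.Properties
    using (∈-++⁺ˡ; ∈-++⁺ʳ; ∈-++⁻; ∈-concatMap⁺; ∈-concatMap⁻; ∈-map⁺; ∈-map⁻; ∈-applyDownFrom⁺; ∈-applyDownFrom⁻; ∈-downFrom⁺)
  open import Data.List.Relation.Unary.Any using (here)
  open import Data.List.Relation.Unary.All as All using (All; []; _∷_)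
  open import Data.List.Relation.Unary.AllPairs using (AllPairs; []; _∷_)
  import Data.List.Relation.Unary.AllPairs.Properties as AllPairs
  open import Data.List.Relation.Unary.Unique.Propositional using (Unique)
  import Data.List.Relation.Unary.Unique.Propositional.Properties as Unique
  open import Data.Product using (_×_; _,_; proj₁; proj₂; ∃)
  open import Data.Sum using (_⊎_; inj₁; inj₂)
  open import Function using (id; _∘_; _⇔_; mk⇔; Equivalence)
  open import Relation.Nullary using (¬_)
  open import Relation.Binary.PropositionalEquality

  Point : Set
  Point = ℕ × ℕ

  InRegion : Point → Set
  InRegion (a , b) = a ≤ b × a + b ≤ r + r

  infix 4 _≻_
  _≻_ : Point → Point → Set
  (a , b) ≻ (a′ , b′) = a′ < a × b′ < b

  IsChain : List Point → Set
  IsChain = AllPairs _≻_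

  Below : ℕ → ℕ → Point → Set
  Below m B (a , b) = a < m × b < B

  IsChainBelow : ℕ → ℕ → List Point → Set
  IsChainBelow m B c = All (λ P → InRegion P × Below m B P) c × IsChain c

  topBound : ℕ → ℕ → ℕ
  topBound m B = B ⊓ suc (r + r ∸ m)

  tops : ℕ → ℕ → List ℕ
  tops m B = applyDownFrom (m +_) (topBound m B ∸ m)

  ∈-tops⇔ : ∀ {m B b} → b ∈ tops m B ⇔ (InRegion (m , b) × b < B)
  ∈-tops⇔ {m} {B} {b} = mk⇔ to from
    where
      hi = topBound m B
      to : b ∈ tops m B → InRegion (m , b) × b < B
      to b∈ with i , i<d , refl ← ∈-applyDownFrom⁻ (m +_) b∈ =
        (ℕ.m≤m+n m i , m+b≤2r) , ℕ.<-≤-trans b<hi (ℕ.m⊓n≤m B _)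
        where
          m<hi : m < hi
          m<hi = ℕ.m∸n≢0⇒n<m (λ d≡0 → ℕ.n≮0 (subst (i <_) d≡0 i<d))
          b<hi : m + i < hi
          b<hi = subst (m + i <_) (ℕ.m+[n∸m]≡n (ℕ.<⇒≤ m<hi)) (ℕ.+-monoʳ-< m i<d)
          b≤2r∸m : m + i ≤ r + r ∸ m
          b≤2r∸m = ℕ.≤-pred (ℕ.<-≤-trans b<hi (ℕ.m⊓n≤n B _))
          m+b≤2r : m + (m + i) ≤ r + r
          m+b≤2r = subst (_≤ r + r) (ℕ.+-comm (m + i) m)
            (ℕ.m≤o∸n⇒m+n≤o (m + i) (ℕ.≤-trans (ℕ.m≤m+n m i) (ℕ.≤-trans b≤2r∸m (ℕ.m∸n≤m _ m))) b≤2r∸m)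
      from : InRegion (m , b) × b < B → b ∈ tops m B
      from ((m≤b , m+b≤2r) , b<B) = subst (_∈ tops m B) (ℕ.m+[n∸m]≡n m≤b)
        (∈-applyDownFrom⁺ (m +_) (ℕ.∸-monoˡ-< b<hi m≤b))
        where
          b<hi : b < hi
          b<hi = ℕ.⊓-glb b<B (s≤s (ℕ.m+n≤o⇒m≤o∸n b (subst (_≤ r + r) (ℕ.+-comm m b) m+b≤2r)))

  chains : ℕ → ℕ → ℕ → List (List Point)
  chainsTopped : ℕ → ℕ → ℕ → List (List Point)

  chains _       _ zero    = [] ∷ []
  chains zero    _ (suc k) = []
  chains (suc m) B (suc k) = chains m B (suc k) ++ chainsTopped m B k

  chainsTopped m B k = concatMap (λ b → List.map ((m , b) ∷_) (chains m b k)) (tops m B)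

  ∈-chainsTopped⁻ : ∀ {m B k c} → c ∈ chainsTopped m B k →
    ∃ λ b → ∃ λ c′ → b ∈ tops m B × c′ ∈ chains m b k × c ≡ (m , b) ∷ c′
  ∈-chainsTopped⁻ {m} {B} {k} c∈
    with b , b∈ , c∈b ← find (∈-concatMap⁻ (λ b → List.map ((m , b) ∷_) (chains m b k)) {xs = tops m B} c∈)
    with c′ , c′∈ , refl ← ∈-map⁻ ((m , b) ∷_) c∈b = b , c′ , b∈ , c′∈ , refl

  chains-sound : ∀ m B k {c} → c ∈ chains m B k → IsChainBelow m B c × length c ≡ k
  chains-sound m       B zero    (here refl) = ([] , []) , refl
  chains-sound (suc m) B (suc k) c∈ with ∈-++⁻ (chains m B (suc k)) c∈
  ... | inj₁ c∈₁ with (inR , chain) , len ← chains-sound m B (suc k) c∈₁ =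
    (All.map (λ (PinR , a<m , b<B) → PinR , ℕ.m<n⇒m<1+n a<m , b<B) inR , chain) , len
  ... | inj₂ c∈₂ with b , c′ , b∈ , c′∈ , refl ← ∈-chainsTopped⁻ {m} {B} {k} c∈₂
                 with (inR , chain) , len ← chains-sound m b k c′∈
                 with mbInR , b<B ← Equivalence.to ∈-tops⇔ b∈ =
    ((mbInR , ℕ.n<1+n m , b<B) ∷ All.map (λ (PinR , a<m , b′<b) → PinR , ℕ.m<n⇒m<1+n a<m , ℕ.<-trans b′<b b<B) inR ,
     All.map proj₂ inR ∷ chain) , cong suc len

  chains-complete : ∀ m B {c} → IsChainBelow m B c → c ∈ chains m B (length c)
  chains-complete m       B {[]}    _ = here refl
  chains-complete zero    B {_ ∷ _} ((_ , () , _) ∷ _ , _)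
  chains-complete (suc m) B {(a , b) ∷ c} ((PinR , a<1+m , b<B) ∷ inR , P≻c ∷ chain)
    with ℕ.m≤n⇒m<n∨m≡n (ℕ.≤-pred a<1+m)
  ... | inj₁ a<m = ∈-++⁺ˡ (chains-complete m B ((PinR , a<m , b<B) ∷ lowered , P≻c ∷ chain))
    where lowered = All.zipWith (λ ((QinR , _ , b′<B) , (a′<a , _)) → QinR , ℕ.<-trans a′<a a<m , b′<B) (inR , P≻c)
  ... | inj₂ refl = ∈-++⁺ʳ (chains a B (suc (length c)))
    (∈-concatMap⁺ (λ b → List.map ((a , b) ∷_) (chains a b (length c)))
      (lose (Equivalence.from ∈-tops⇔ (PinR , b<B)) (∈-map⁺ ((a , b) ∷_) (chains-complete a b (under , chain)))))
    where under = All.zipWith (λ ((QinR , _) , Q≺P) → QinR , Q≺P) (inR , P≻c)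

  chains-unique : ∀ m B k → Unique (chains m B k)
  chains-unique m       B zero    = [] ∷ []
  chains-unique zero    B (suc k) = []
  chains-unique (suc m) B (suc k) = Unique.++⁺ (chains-unique m B (suc k)) topped-unique disjoint
    where
      topped-unique : Unique (chainsTopped m B k)
      topped-unique = concatMap-unique (λ b → List.map ((m , b) ∷_) (chains m b k))
        (Unique.applyDownFrom⁺₁ (m +_) (topBound m B ∸ m) λ j<i _ → ℕ.<⇒≢ (ℕ.+-monoʳ-< m j<i) ∘ sym)
        (λ b → Unique.map⁺ (λ eq → proj₂ (∷-injective eq)) (chains-unique m b k))
        λ {b} {b′} c∈b c∈b′ →
          let _ , _ , eq  = ∈-map⁻ ((m , b) ∷_) c∈b
              _ , _ , eq′ = ∈-map⁻ ((m , b′) ∷_) c∈b′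
          in cong proj₂ (proj₁ (∷-injective (trans (sym eq) eq′)))
      disjoint : ∀ {c} → ¬ (c ∈ chains m B (suc k) × c ∈ chainsTopped m B k)
      disjoint (c∈₁ , c∈₂) with _ , _ , _ , _ , refl ← ∈-chainsTopped⁻ {m} {B} {k} c∈₂
                           with ((_ , m<m , _) ∷ _ , _) , _ ← chains-sound m B (suc k) c∈₁ = ℕ.<-irrefl refl m<m

  length-chains : ∀ m B k → length (chains (suc m) B (suc k)) ≡
    length (chains m B (suc k)) + sum (List.map (λ b → length (chains m b k)) (tops m B))
  length-chains m B k = trans (length-++ (chains m B (suc k))) (cong (length (chains m B (suc k)) +_) (length-topped (tops m B)))
    where
      length-topped : ∀ bs → length (concatMap (λ b → List.map ((m , b) ∷_) (chains m b k)) bs)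
                              ≡ sum (List.map (λ b → length (chains m b k)) bs)
      length-topped []       = refl
      length-topped (b ∷ bs) = trans (length-++ (List.map ((m , b) ∷_) (chains m b k)))
                                     (cong₂ _+_ (length-map _ (chains m b k)) (length-topped bs))

  LexGt : Point → Point → Set
  LexGt (a , b) (a′ , b′) = a′ < a ⊎ a′ ≡ a × b′ < b

  grid : ℕ → ℕ → List Point
  grid zero    M = []
  grid (suc A) M = List.map (A ,_) (downFrom M) ++ grid A M

  ∈-grid⁺ : ∀ {a b A M} → a < A → b < M → (a , b) ∈ grid A M
  ∈-grid⁺ {a} {b} {suc A} {M} a<A+1 b<M with ℕ.m≤n⇒m<n∨m≡n (ℕ.≤-pred a<A+1)
  ... | inj₂ refl = ∈-++⁺ˡ (∈-map⁺ (a ,_) (∈-downFrom⁺ b<M))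
  ... | inj₁ a<A  = ∈-++⁺ʳ (List.map (A ,_) (downFrom M)) (∈-grid⁺ a<A b<M)

  ∈-grid⁻ : ∀ {P A M} → P ∈ grid A M → proj₁ P < A
  ∈-grid⁻ {P} {suc A} {M} P∈ with ∈-++⁻ (List.map (A ,_) (downFrom M)) P∈
  ... | inj₁ P∈row with _ , _ , refl ← ∈-map⁻ (A ,_) P∈row = ℕ.≤-refl
  ... | inj₂ P∈grid = ℕ.m<n⇒m<1+n (∈-grid⁻ {P} {A} P∈grid)

  grid-sorted : ∀ A M → AllPairs LexGt (grid A M)
  grid-sorted zero    M = []
  grid-sorted (suc A) M = AllPairs.++⁺
    (AllPairs.map⁺ (AllPairs.applyDownFrom⁺₁ id M (λ j<i _ → inj₂ (refl , j<i))))
    (grid-sorted A M)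
    (All.tabulate λ P∈row → All.tabulate λ Q∈grid →
      let _ , _ , P≡ = ∈-map⁻ (A ,_) P∈row in subst (λ P → LexGt P _) (sym P≡) (inj₁ (∈-grid⁻ Q∈grid)))

module ChainCount (r : ℕ) where

  open RegionChains r
  open import Data.Nat as ℕ using (ℕ; zero; suc; _≤_; _<_; z≤n; s≤s; _∸_; _⊓_)
  import Data.Nat.Properties as ℕ
  open import Data.Nat.Combinatorics using (_C_; nCk+nC[k+1]≡[n+1]C[k+1])
  open import Data.Nat.ListAction using (sum)
  open import Data.Integer as ℤ using (ℤ; +_; _+_; _*_; _-_)
  import Data.Integer.Properties as ℤ
  open import Data.Integer.Solver using (module +-*-Solver)
  open import Data.List as List using (List; length; applyDownFrom)
  open import Relation.Binary.PropositionalEquality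
  open +-*-Solver

  binom : ℕ → ℕ → ℤ
  binom n k = + (n C k)

  binom⁻ : ℕ → ℕ → ℤ
  binom⁻ n zero    = + 0
  binom⁻ n (suc k) = binom n k

  pascal : ∀ n k → binom (suc n) (suc k) ≡ binom n k + binom n (suc k)
  pascal n k = trans (cong +_ (sym (nCk+nC[k+1]≡[n+1]C[k+1] n k))) (ℤ.pos-+ (n C k) (n C suc k))

  pascal⁻ : ∀ n k → binom (suc n) k ≡ binom⁻ n k + binom n k
  pascal⁻ n zero    = refl
  pascal⁻ n (suc k) = pascal n k

  -- The number of pairs of k-subsets {a₁ > ⋯} of [0, m) and {b₁ > ⋯} of [0, B) with aᵢ ≤ bᵢ,
  -- by the reflection principle.
  ballot : ℕ → ℕ → ℕ → ℤ
  ballot m B k = binom m k * binom B k - binom m (suc k) * binom⁻ B k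

  #chains : ℕ → ℕ → ℕ → ℕ
  #chains m B k = length (chains m B k)

  Σ#chains : ℕ → ℕ → List ℕ → ℕ
  Σ#chains m k bs = sum (List.map (λ b → #chains m b k) bs)

  #chains-suc : ∀ m B k → + #chains (suc m) B (suc k) ≡ + #chains m B (suc k) + + Σ#chains m k (tops m B)
  #chains-suc m B k = trans (cong +_ (length-chains m B k)) (ℤ.pos-+ (#chains m B (suc k)) _)

  -- Σ_{m ≤ b < m + d} ballot m b k telescopes by Pascal's rule.
  sum-ballot : ∀ m k d → (∀ i → i < d → + #chains m (m ℕ.+ i) k ≡ ballot m (m ℕ.+ i) k) →
    + Σ#chains m k (applyDownFrom (m ℕ.+_) d) ≡ binom m k * binom (m ℕ.+ d) (suc k) - binom m (suc k) * binom (m ℕ.+ d) k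
  sum-ballot m k zero    _ rewrite ℕ.+-identityʳ m =
    solve 2 (λ x y → con (+ 0) := x :* y :- y :* x) refl (binom m k) (binom m (suc k))
  sum-ballot m k (suc d) count = begin
    + (#chains m (m ℕ.+ d) k ℕ.+ Σ#chains m k (applyDownFrom (m ℕ.+_) d))
      ≡⟨ ℤ.pos-+ (#chains m (m ℕ.+ d) k) _ ⟩
    + #chains m (m ℕ.+ d) k + + Σ#chains m k (applyDownFrom (m ℕ.+_) d)
      ≡⟨ cong₂ _+_ (count d ℕ.≤-refl) (sum-ballot m k d (λ i i<d → count i (ℕ.m<n⇒m<1+n i<d))) ⟩
    (x₀ * Y₀ - x₁ * Y₋) + (x₀ * Y₁ - x₁ * Y₀)
      ≡⟨ solve 5 (λ x₀ x₁ Y₋ Y₀ Y₁ → (x₀ :* Y₀ :- x₁ :* Y₋) :+ (x₀ :* Y₁ :- x₁ :* Y₀)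
                                    := x₀ :* (Y₀ :+ Y₁) :- x₁ :* (Y₋ :+ Y₀)) refl x₀ x₁ Y₋ Y₀ Y₁ ⟩
    x₀ * (Y₀ + Y₁) - x₁ * (Y₋ + Y₀)
      ≡⟨ cong₂ (λ u v → x₀ * u - x₁ * v) (pascal (m ℕ.+ d) k) (pascal⁻ (m ℕ.+ d) k) ⟨
    x₀ * binom (suc (m ℕ.+ d)) (suc k) - x₁ * binom (suc (m ℕ.+ d)) k
      ≡⟨ cong (λ t → x₀ * binom t (suc k) - x₁ * binom t k) (ℕ.+-suc m d) ⟨
    x₀ * binom (m ℕ.+ suc d) (suc k) - x₁ * binom (m ℕ.+ suc d) k ∎
    where
      open ≡-Reasoning
      x₀ = binom m k
      x₁ = binom m (suc k)
      Y₋ = binom⁻ (m ℕ.+ d) k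
      Y₀ = binom (m ℕ.+ d) k
      Y₁ = binom (m ℕ.+ d) (suc k)

  tops-uncut : ∀ {m B} → B ℕ.+ m ≤ suc (r ℕ.+ r) → tops m B ≡ applyDownFrom (m ℕ.+_) (B ∸ m)
  tops-uncut {m} {B} B+m≤ = cong (λ h → applyDownFrom (m ℕ.+_) (h ∸ m))
    (ℕ.m≤n⇒m⊓n≡m (ℕ.≤-trans (ℕ.m+n≤o⇒m≤o∸n B B+m≤) (suc∸≤ (r ℕ.+ r) m)))
    where
      suc∸≤ : ∀ n m → suc n ∸ m ≤ suc (n ∸ m)
      suc∸≤ n       zero    = ℕ.≤-refl
      suc∸≤ zero    (suc m) = subst (_≤ suc (0 ∸ suc m)) (sym (ℕ.0∸n≡0 m)) z≤n
      suc∸≤ (suc n) (suc m) = suc∸≤ n m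

  -- Away from the anti-diagonal a + b = 2r only the constraint a ≤ b is active.
  #chains-uncut : ∀ m B k → m ≤ suc B → B ℕ.+ m ≤ suc (suc (r ℕ.+ r)) → + #chains m B k ≡ ballot m B k
  #chains-uncut zero    B zero    _ _ = refl
  #chains-uncut zero    B (suc k) _ _ =
    solve 2 (λ x y → con (+ 0) := con (+ 0) :* x :- con (+ 0) :* y) refl (binom B (suc k)) (binom B k)
  #chains-uncut (suc m) B zero    _ _ =
    solve 1 (λ x → con (+ 1) := con (+ 1) :* con (+ 1) :- x :* con (+ 0)) refl (binom (suc m) 1)
  #chains-uncut (suc m) B (suc k) m<B+1 B+m+1≤ = begin
    + #chains (suc m) B (suc k)                           ≡⟨ #chains-suc m B k ⟩
    + #chains m B (suc k) + + Σ#chains m k (tops m B)      ≡⟨ cong₂ _+_ IH topped ⟩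
    (x₁ * y₁ - x₂ * y₀) + (x₀ * y₁ - x₁ * y₀)
      ≡⟨ solve 5 (λ x₀ x₁ x₂ y₀ y₁ → (x₁ :* y₁ :- x₂ :* y₀) :+ (x₀ :* y₁ :- x₁ :* y₀)
                                    := (x₀ :+ x₁) :* y₁ :- (x₁ :+ x₂) :* y₀) refl x₀ x₁ x₂ y₀ y₁ ⟩
    (x₀ + x₁) * y₁ - (x₁ + x₂) * y₀
      ≡⟨ cong₂ (λ u v → u * y₁ - v * y₀) (pascal m k) (pascal m (suc k)) ⟨
    ballot (suc m) B (suc k)                              ∎
    where
      open ≡-Reasoning
      m≤B = ℕ.≤-pred m<B+1
      B+m≤ : B ℕ.+ m ≤ suc (r ℕ.+ r)
      B+m≤ = ℕ.≤-pred (subst (_≤ suc (suc (r ℕ.+ r))) (ℕ.+-suc B m) B+m+1≤)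
      x₀ = binom m k
      x₁ = binom m (suc k)
      x₂ = binom m (suc (suc k))
      y₀ = binom B k
      y₁ = binom B (suc k)
      IH = #chains-uncut m B (suc k) (ℕ.m≤n⇒m≤1+n m≤B) (ℕ.≤-trans (ℕ.+-monoʳ-≤ B (ℕ.n≤1+n m)) B+m+1≤)
      count : ∀ i → i < B ∸ m → + #chains m (m ℕ.+ i) k ≡ ballot m (m ℕ.+ i) k
      count i i<B∸m = #chains-uncut m (m ℕ.+ i) k (ℕ.m≤n⇒m≤1+n (ℕ.m≤m+n m i))
        (ℕ.≤-trans (ℕ.+-monoˡ-≤ m (ℕ.<⇒≤ m+i<B)) (ℕ.m≤n⇒m≤1+n B+m≤))
        where m+i<B = subst (m ℕ.+ i <_) (ℕ.m+[n∸m]≡n m≤B) (ℕ.+-monoʳ-< m i<B∸m)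
      topped : + Σ#chains m k (tops m B) ≡ x₀ * y₁ - x₁ * y₀
      topped = begin
        + Σ#chains m k (tops m B)                           ≡⟨ cong (λ bs → + Σ#chains m k bs) (tops-uncut {m} {B} B+m≤) ⟩
        + Σ#chains m k (applyDownFrom (m ℕ.+_) (B ∸ m))     ≡⟨ sum-ballot m k (B ∸ m) count ⟩
        x₀ * binom (m ℕ.+ (B ∸ m)) (suc k) - x₁ * binom (m ℕ.+ (B ∸ m)) k
          ≡⟨ cong (λ t → x₀ * binom t (suc k) - x₁ * binom t k) (ℕ.m+[n∸m]≡n m≤B) ⟩
        x₀ * y₁ - x₁ * y₀                                   ∎

  tops-cut : ∀ {m n} → m ℕ.+ n ≡ suc (r ℕ.+ r) → m < n → tops m (suc (r ℕ.+ r)) ≡ tops m n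
  tops-cut {m} {n} m+n≡ m<n = trans (cong (λ h → applyDownFrom (m ℕ.+_) (h ∸ m)) full≡n) (sym (tops-uncut {m} {n} n+m≤))
    where
      n+m≤ = ℕ.≤-reflexive (trans (ℕ.+-comm n m) m+n≡)
      m≤2r : m ≤ r ℕ.+ r
      m≤2r = ℕ.≤-pred (subst (suc m ≤_) m+n≡ (subst (_≤ m ℕ.+ n) (ℕ.+-comm m 1) (ℕ.+-monoʳ-≤ m (ℕ.≤-trans (s≤s z≤n) m<n))))
      n≡ : suc (r ℕ.+ r ∸ m) ≡ n
      n≡ = trans (sym (ℕ.+-∸-assoc 1 m≤2r)) (trans (cong (_∸ m) (sym m+n≡)) (ℕ.m+n∸m≡n m n))
      full≡n : topBound m (suc (r ℕ.+ r)) ≡ n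
      full≡n = trans (cong (suc (r ℕ.+ r) ⊓_) n≡) (ℕ.m≥n⇒m⊓n≡n (subst (n ≤_) m+n≡ (ℕ.m≤n+m n m)))

  topped-full : ∀ {m n} k → m < n → m ℕ.+ n ≡ suc (r ℕ.+ r) →
    + Σ#chains m k (tops m (suc (r ℕ.+ r))) ≡ ballot (suc m) n (suc k) - ballot m n (suc k)
  topped-full {m} {n} k m<n m+n≡ = begin
    + Σ#chains m k (tops m (suc (r ℕ.+ r)))          ≡⟨ cong (λ bs → + Σ#chains m k bs) (tops-cut m+n≡ m<n) ⟩
    + T                                              ≡⟨ solve 2 (λ t c → t := (c :+ t) :- c) refl (+ T) (+ #chains m n (suc k)) ⟩
    (+ #chains m n (suc k) + + T) - + #chains m n (suc k)
      ≡⟨ cong₂ _-_ (trans (sym (#chains-suc m n k)) (#chains-uncut (suc m) n (suc k) (ℕ.m≤n⇒m≤1+n m<n) (subst (_≤ suc (suc (r ℕ.+ r))) (sym (ℕ.+-suc n m)) (s≤s n+m≤))))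
                   (#chains-uncut m n (suc k) (ℕ.m≤n⇒m≤1+n (ℕ.<⇒≤ m<n)) (ℕ.m≤n⇒m≤1+n n+m≤)) ⟩
    ballot (suc m) n (suc k) - ballot m n (suc k)    ∎
    where
      open ≡-Reasoning
      T = Σ#chains m k (tops m n)
      n+m≤ = ℕ.≤-reflexive (trans (ℕ.+-comm n m) m+n≡)

  #chains-full : ∀ m n k → m ≤ n → m ℕ.+ n ≡ suc (suc (r ℕ.+ r)) →
    + #chains m (suc (r ℕ.+ r)) k ≡ binom m k * binom n k
  #chains-full zero    n zero    _ _ = refl
  #chains-full zero    n (suc k) _ _ = solve 1 (λ x → con (+ 0) := con (+ 0) :* x) refl (binom n (suc k))
  #chains-full (suc m) n zero    _ _ = refl
  #chains-full (suc m) n (suc k) m<n m+n+1≡ = begin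
    + #chains (suc m) R (suc k)                                          ≡⟨ #chains-suc m R k ⟩
    + #chains m R (suc k) + + Σ#chains m k (tops m R)
      ≡⟨ cong₂ _+_ (#chains-full m (suc n) (suc k) (ℕ.m≤n⇒m≤1+n (ℕ.<⇒≤ m<n)) (trans (ℕ.+-suc m n) m+n+1≡))
                   (topped-full k m<n (ℕ.suc-injective m+n+1≡)) ⟩
    x₁ * binom (suc n) (suc k) + (ballot (suc m) n (suc k) - ballot m n (suc k))
      ≡⟨ cong₂ (λ u v → x₁ * u + (v - (x₁ * y₁ - x₂ * y₀)))
               (pascal n k) (cong₂ (λ a b → a * y₁ - b * y₀) (pascal m k) (pascal m (suc k))) ⟩
    x₁ * (y₀ + y₁) + (((x₀ + x₁) * y₁ - (x₁ + x₂) * y₀) - (x₁ * y₁ - x₂ * y₀))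
      ≡⟨ solve 5 (λ x₀ x₁ x₂ y₀ y₁ → x₁ :* (y₀ :+ y₁) :+ (((x₀ :+ x₁) :* y₁ :- (x₁ :+ x₂) :* y₀) :- (x₁ :* y₁ :- x₂ :* y₀))
                                    := (x₀ :+ x₁) :* y₁) refl x₀ x₁ x₂ y₀ y₁ ⟩
    (x₀ + x₁) * y₁                                                       ≡⟨ cong (_* y₁) (pascal m k) ⟨
    binom (suc m) (suc k) * binom n (suc k)                              ∎
    where
      open ≡-Reasoning
      R = suc (r ℕ.+ r)
      x₀ = binom m k
      x₁ = binom m (suc k)
      x₂ = binom m (suc (suc k))
      y₀ = binom n k
      y₁ = binom n (suc k)

  #chains-total : ∀ k → #chains (suc r) (suc (r ℕ.+ r)) k ≡ (suc r C k) ℕ.* (suc r C k)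
  #chains-total k = ℤ.+-injective (trans (#chains-full (suc r) (suc r) k ℕ.≤-refl (cong suc (ℕ.+-suc r r)))
                                         (sym (ℤ.pos-* (suc r C k) (suc r C k))))

module RegionRoots (r : ℕ) where

  open import Defs using (V; e; α; _⊕_; _⊖_; _·_; _≼_; IsShort; InΠs)
  open Vectors
  open RootForms
  open Dominance
  open RegionChains r using (Point; InRegion; _≻_)
  open import Data.Nat as ℕ using (ℕ; zero; suc; _+_; _∸_; _≤_; _<_; z≤n; s≤s; _<ᵇ_)
  import Data.Nat.Properties as ℕ
  open import Data.Integer as ℤ using (ℤ; +_)
  import Data.Integer.Properties as ℤ
  open import Data.Fin using (fromℕ<)
  import Data.Fin.Properties as Fin
  open import Data.Bool using (if_then_else_)
  open import Data.Product using (∃; _×_; _,_; proj₁; proj₂)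
  open import Data.Sum using (_⊎_; inj₁; inj₂)
  open import Data.Empty using (⊥-elim)
  open import Relation.Nullary using (¬_)
  open import Relation.Binary.Definitions using (tri<; tri≈; tri>)
  open import Relation.Binary.PropositionalEquality

  p : ℕ
  p = suc (suc r)

  pointForm : Point → RootForm
  pointForm (a , b) = if b <ᵇ r then minus a (suc (suc b)) else plus a (suc (r + r) ∸ b)

  rootOf : Point → V p
  rootOf P = vec (pointForm P)

  pointForm-shape : ∀ a b → b < r × pointForm (a , b) ≡ minus a (suc (suc b))
                          ⊎ r ≤ b × pointForm (a , b) ≡ plus a (suc (r + r) ∸ b)
  pointForm-shape a b with ℕ.<-≤-connex b r
  ... | inj₁ b<r rewrite <⇒<ᵇ b<r = inj₁ (b<r , refl)
  ... | inj₂ r≤b rewrite ≤⇒≮ᵇ r≤b = inj₂ (r≤b , refl)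

  pointForm-below : ∀ {a b} → b < r → pointForm (a , b) ≡ minus a (suc (suc b))
  pointForm-below {a} {b} b<r with pointForm-shape a b
  ... | inj₁ (_ , eq)   = eq
  ... | inj₂ (r≤b , _) = ⊥-elim (ℕ.<⇒≱ b<r r≤b)

  pointForm-above : ∀ {a b} → r ≤ b → pointForm (a , b) ≡ plus a (suc (r + r) ∸ b)
  pointForm-above {a} {b} r≤b with pointForm-shape a b
  ... | inj₁ (b<r , _) = ⊥-elim (ℕ.<⇒≱ b<r r≤b)
  ... | inj₂ (_ , eq)   = eq

  private
    below-anti-diagonal : ∀ {a b} → a + b ≤ r + r → a < suc (r + r) ∸ b
    below-anti-diagonal {a} {b} a+b≤ = subst (a <_) (sym (ℕ.+-∸-assoc 1 (ℕ.≤-trans (ℕ.m≤n+m b a) a+b≤)))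
      (s≤s (ℕ.m+n≤o⇒m≤o∸n a a+b≤))

    reflected≤r+1 : ∀ {b} → r ≤ b → suc (r + r) ∸ b ≤ suc r
    reflected≤r+1 {b} r≤b = ℕ.≤-trans (ℕ.∸-monoʳ-≤ (suc (r + r)) r≤b) (ℕ.≤-reflexive (ℕ.m+n∸n≡m (suc r) r))

  lead≤r : ∀ {a b} → InRegion (a , b) → a ≤ r
  lead≤r {a} {b} (a≤b , a+b≤2r) with ℕ.<-≤-connex r a
  ... | inj₁ r<a = ⊥-elim (ℕ.<⇒≱ (ℕ.+-mono-< r<a (ℕ.<-≤-trans r<a a≤b)) a+b≤2r)
  ... | inj₂ a≤r = a≤r

  pointForm-valid : ∀ P → InRegion P → Valid p (pointForm P)
  pointForm-valid (a , b) (a≤b , a+b≤) with pointForm-shape a b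
  ... | inj₁ (b<r , eq) = subst (Valid p) (sym eq) (ℕ.m≤n⇒m≤1+n (s≤s a≤b) , s≤s (s≤s b<r))
  ... | inj₂ (r≤b , eq) = subst (Valid p) (sym eq) (below-anti-diagonal a+b≤ , s≤s (reflected≤r+1 r≤b))

  pointForm-lead : ∀ P → lead (pointForm P) ≡ proj₁ P
  pointForm-lead (a , b) with pointForm-shape a b
  ... | inj₁ (_ , eq) = cong lead eq
  ... | inj₂ (_ , eq) = cong lead eq

  pointForm-injective : ∀ P Q → InRegion P → InRegion Q → pointForm P ≡ pointForm Q → P ≡ Q
  pointForm-injective (a , b) (a′ , b′) (_ , a+b≤) (_ , a′+b′≤) eq with pointForm-shape a b | pointForm-shape a′ b′
  ... | inj₁ (_ , e₁) | inj₁ (_ , e₂) with refl ← trans (sym e₁) (trans eq e₂) = refl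
  ... | inj₁ (_ , e₁) | inj₂ (_ , e₂) with () ← trans (sym e₁) (trans eq e₂)
  ... | inj₂ (_ , e₁) | inj₁ (_ , e₂) with () ← trans (sym e₁) (trans eq e₂)
  ... | inj₂ (_ , e₁) | inj₂ (_ , e₂) = cong₂ _,_ (cong lead same)
    (ℕ.∸-cancelˡ-≡ (b≤2r+1 a+b≤) (b≤2r+1 a′+b′≤) (cong partner same))
    where
      same = trans (sym e₁) (trans eq e₂)
      b≤2r+1 : ∀ {a b} → a + b ≤ r + r → b ≤ suc (r + r)
      b≤2r+1 {a} {b} a+b≤ = ℕ.m≤n⇒m≤1+n (ℕ.≤-trans (ℕ.m≤n+m b a) a+b≤)

  rootOf-injective : ∀ P Q → InRegion P → InRegion Q → rootOf P ≡ rootOf Q → P ≡ Q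
  rootOf-injective P Q inP inQ eq =
    pointForm-injective P Q inP inQ (vec-injective _ _ (pointForm-valid P inP) (pointForm-valid Q inQ) eq)

  pointForm-not-double : ∀ P x → pointForm P ≢ double x
  pointForm-not-double (a , b) x eq with pointForm-shape a b
  ... | inj₁ (_ , e₁) with () ← trans (sym e₁) eq
  ... | inj₂ (_ , e₁) with () ← trans (sym e₁) eq

  pointForm-not-adjacent : ∀ P x → InRegion P → pointForm P ≢ minus x (suc x)
  pointForm-not-adjacent (a , b) x (a≤b , _) eq with pointForm-shape a b
  ... | inj₁ (_ , e₁) with refl ← trans (sym e₁) eq = ℕ.<-irrefl refl (s≤s a≤b)
  ... | inj₂ (_ , e₁) with () ← trans (sym e₁) eq

  pointForm-surjective : ∀ F → Valid p F → (∀ x → F ≢ double x) → (∀ x → F ≢ minus x (suc x)) →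
    ∃ λ P → InRegion P × pointForm P ≡ F
  pointForm-surjective (double x) _ F≢double _ = ⊥-elim (F≢double x refl)
  pointForm-surjective (minus x (suc zero)) (s≤s z≤n , _) _ F≢adjacent = ⊥-elim (F≢adjacent 0 refl)
  pointForm-surjective (minus x (suc (suc y))) (x<y+2 , s≤s (s≤s y<r)) _ F≢adjacent
    with ℕ.m≤n⇒m<n∨m≡n (ℕ.≤-pred x<y+2)
  ... | inj₂ refl = ⊥-elim (F≢adjacent x refl)
  ... | inj₁ x<y+1 = (x , y) , (x≤y , x+y≤2r) , pointForm-below y<r
    where
      x≤y = ℕ.≤-pred x<y+1
      x+y≤2r = ℕ.+-mono-≤ (ℕ.≤-trans x≤y (ℕ.<⇒≤ y<r)) (ℕ.<⇒≤ y<r)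
  pointForm-surjective (plus x y) (x<y , s≤s y≤r+1) _ _ =
    (x , b) , (ℕ.≤-trans x≤r r≤b , x+b≤2r) , trans (pointForm-above r≤b) (cong (plus x) (ℕ.m∸[m∸n]≡n y≤2r+1))
    where
      b = suc (r + r) ∸ y
      y≤2r+1 : y ≤ suc (r + r)
      y≤2r+1 = ℕ.≤-trans y≤r+1 (s≤s (ℕ.m≤m+n r r))
      x≤r : x ≤ r
      x≤r = ℕ.≤-pred (ℕ.<-≤-trans x<y y≤r+1)
      r≤b : r ≤ b
      r≤b = ℕ.m+n≤o⇒m≤o∸n r (subst (r + y ≤_) (ℕ.+-suc r r) (ℕ.+-monoʳ-≤ r y≤r+1))
      x+b≤2r : x + b ≤ r + r
      x+b≤2r = subst (_≤ r + r) (ℕ.+-∸-assoc x y≤2r+1)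
        (ℕ.m≤n+o⇒m∸n≤o (x + suc (r + r)) y (subst (_≤ y + (r + r)) (sym (ℕ.+-suc x (r + r))) (ℕ.+-monoˡ-≤ (r + r) x<y)))

  rootOf-short : ∀ P → InRegion P → IsShort (rootOf P)
  rootOf-short P inP = vec-short (pointForm P) (pointForm-valid P inP) (pointForm-not-double P)

  rootOf-∉Πs : ∀ P → InRegion P → ¬ InΠs (rootOf P)
  rootOf-∉Πs P inP inΠs with x , eq ← InΠs⇒adjacent (pointForm P) (pointForm-valid P inP) inΠs =
    pointForm-not-adjacent P x inP eq

  short-nonsimple⇒rootOf : ∀ F → Valid p F → IsShort (vec {p} F) → ¬ InΠs (vec {p} F) →
    ∃ λ P → InRegion P × rootOf P ≡ vec F
  short-nonsimple⇒rootOf F vF short ∉Πs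
    with P , inP , eq ← pointForm-surjective F vF (λ { x refl → double-long vF short })
                                                  (λ { x refl → ∉Πs (adjacent⇒InΠs (proj₂ vF)) })
    = P , inP , cong vec eq

  private
    α-at : ∀ {x} → suc x < p → ∃ λ l → α l ≡ e x ⊖ e (suc x)
    α-at {x} x+1<p = l , trans (α-short l (subst (λ t → suc t < p) (sym toℕl≡x) x+1<p)) (cong (λ t → e t ⊖ e (suc t)) toℕl≡x)
      where
        x<p = ℕ.<-trans (ℕ.n<1+n x) x+1<p
        l = fromℕ< x<p
        toℕl≡x = Fin.toℕ-fromℕ< x<p

    α-last : ∃ λ l → α l ≡ (+ 2) · e (suc r)
    α-last = l , trans (α-long l (cong suc toℕl≡r+1)) (cong (λ t → (+ 2) · e t) toℕl≡r+1)
      where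
        l = fromℕ< (ℕ.n<1+n (suc r))
        toℕl≡r+1 = Fin.toℕ-fromℕ< (ℕ.n<1+n (suc r))

    shift-a : ∀ a b → InRegion (suc a , b) → ∃ λ l → rootOf (suc a , b) ⊕ α l ≡ rootOf (a , b)
    shift-a a b inR with l , αl≡ ← α-at (ℕ.m≤n⇒m≤1+n (s≤s (lead≤r inR))) | ℕ.<-≤-connex b r
    ... | inj₁ b<r = l , (begin
      vec (pointForm (suc a , b)) ⊕ α l                  ≡⟨ cong₂ _⊕_ (cong vec (pointForm-below b<r)) αl≡ ⟩
      (e (suc a) ⊖ e (suc (suc b))) ⊕ (e a ⊖ e (suc a))  ≡⟨ ⊕-comm (e (suc a) ⊖ e (suc (suc b))) (e a ⊖ e (suc a)) ⟩
      (e a ⊖ e (suc a)) ⊕ (e (suc a) ⊖ e (suc (suc b)))  ≡⟨ ⊖-telescope (e a) (e (suc a)) (e (suc (suc b))) ⟩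
      e a ⊖ e (suc (suc b))                              ≡⟨ cong vec (pointForm-below b<r) ⟨
      vec (pointForm (a , b))                            ∎)
      where open ≡-Reasoning
    ... | inj₂ r≤b = l , (begin
      vec (pointForm (suc a , b)) ⊕ α l                  ≡⟨ cong₂ _⊕_ (cong vec (pointForm-above r≤b)) αl≡ ⟩
      (e (suc a) ⊕ e c) ⊕ (e a ⊖ e (suc a))              ≡⟨ ⊕-comm (e (suc a) ⊕ e c) (e a ⊖ e (suc a)) ⟩
      (e a ⊖ e (suc a)) ⊕ (e (suc a) ⊕ e c)              ≡⟨ ⊖-⊕-telescope (e a) (e (suc a)) (e c) ⟩
      e a ⊕ e c                                          ≡⟨ cong vec (pointForm-above r≤b) ⟨
      vec (pointForm (a , b))                            ∎)
      where
        open ≡-Reasoning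
        c = suc (r + r) ∸ b

    shift-b-below : ∀ a b → suc b < r → ∃ λ l → rootOf (a , b) ⊕ α l ≡ rootOf (a , suc b)
    shift-b-below a b b+1<r with l , αl≡ ← α-at {suc (suc b)} (s≤s (s≤s b+1<r)) = l , (begin
      vec (pointForm (a , b)) ⊕ α l
        ≡⟨ cong₂ _⊕_ (cong vec (pointForm-below (ℕ.<-trans (ℕ.n<1+n b) b+1<r))) αl≡ ⟩
      (e a ⊖ e (suc (suc b))) ⊕ (e (suc (suc b)) ⊖ e (suc (suc (suc b))))
        ≡⟨ ⊖-telescope (e a) (e (suc (suc b))) (e (suc (suc (suc b)))) ⟩
      e a ⊖ e (suc (suc (suc b)))
        ≡⟨ cong vec (pointForm-below b+1<r) ⟨
      vec (pointForm (a , suc b)) ∎)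
      where open ≡-Reasoning

    shift-b-across : ∀ a b → suc b ≡ r → ∃ λ l → rootOf (a , b) ⊕ α l ≡ rootOf (a , suc b)
    shift-b-across a b b+1≡r with l , αl≡ ← α-last = l , (begin
      vec (pointForm (a , b)) ⊕ α l
        ≡⟨ cong₂ _⊕_ (cong vec (pointForm-below (subst (b <_) b+1≡r (ℕ.n<1+n b)))) αl≡ ⟩
      (e a ⊖ e (suc (suc b))) ⊕ (+ 2) · e (suc r)
        ≡⟨ cong (λ t → (e a ⊖ e (suc t)) ⊕ (+ 2) · e (suc r)) b+1≡r ⟩
      (e a ⊖ e (suc r)) ⊕ (+ 2) · e (suc r)
        ≡⟨ ⊖-⊕-double (e a) (e (suc r)) ⟩
      e a ⊕ e (suc r)
        ≡⟨ cong (λ t → e a ⊕ e t) (trans (cong (suc (r + r) ∸_) b+1≡r) (ℕ.m+n∸n≡m (suc r) r)) ⟨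
      e a ⊕ e (suc (r + r) ∸ suc b)
        ≡⟨ cong vec (pointForm-above (ℕ.≤-reflexive (sym b+1≡r))) ⟨
      vec (pointForm (a , suc b)) ∎)
      where open ≡-Reasoning

    shift-b-above : ∀ a b → r ≤ b → b ≤ r + r → ∃ λ l → rootOf (a , b) ⊕ α l ≡ rootOf (a , suc b)
    shift-b-above a b r≤b b≤2r with l , αl≡ ← α-at {r + r ∸ b} (s≤s (s≤s (ℕ.m≤n+o⇒m∸n≤o (r + r) b (ℕ.+-monoˡ-≤ r r≤b)))) =
      l , (begin
      vec (pointForm (a , b)) ⊕ α l
        ≡⟨ cong₂ _⊕_ (cong vec (pointForm-above r≤b)) αl≡ ⟩
      (e a ⊕ e (suc (r + r) ∸ b)) ⊕ (e w ⊖ e (suc w))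
        ≡⟨ cong (λ t → (e a ⊕ e t) ⊕ (e w ⊖ e (suc w))) (ℕ.+-∸-assoc 1 b≤2r) ⟩
      (e a ⊕ e (suc w)) ⊕ (e w ⊖ e (suc w))
        ≡⟨ ⊕-⊖-cancelʳ (e a) (e (suc w)) (e w) ⟩
      e a ⊕ e w
        ≡⟨ cong vec (pointForm-above (ℕ.m≤n⇒m≤1+n r≤b)) ⟨
      vec (pointForm (a , suc b)) ∎)
      where
        open ≡-Reasoning
        w = r + r ∸ b

  rootOf-step-a : ∀ a b → InRegion (suc a , b) → rootOf (suc a , b) ≼ rootOf (a , b)
  rootOf-step-a a b inR = let l , shifted = shift-a a b inR in ≼-step l shifted

  rootOf-step-b : ∀ a b → InRegion (a , suc b) → rootOf (a , b) ≼ rootOf (a , suc b)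
  rootOf-step-b a b (_ , a+b+1≤2r) with ℕ.<-cmp (suc b) r
  ... | tri< b+1<r _ _ = let l , shifted = shift-b-below a b b+1<r in ≼-step l shifted
  ... | tri≈ _ b+1≡r _ = let l , shifted = shift-b-across a b b+1≡r in ≼-step l shifted
  ... | tri> _ _ r<b+1 = let l , shifted = shift-b-above a b (ℕ.≤-pred r<b+1) b≤2r in ≼-step l shifted
    where b≤2r = ℕ.≤-trans (ℕ.n≤1+n b) (ℕ.≤-trans (ℕ.m≤n+m (suc b) a) a+b+1≤2r)

  rootOf-antitone-a : ∀ d {a b} → InRegion (d + a , b) → rootOf (d + a , b) ≼ rootOf (a , b)
  rootOf-antitone-a zero    _ = ≼-refl _
  rootOf-antitone-a (suc d) {a} {b} inR@(a+d+1≤b , s) =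
    ≼-trans (rootOf-step-a (d + a) b inR) (rootOf-antitone-a d (ℕ.<⇒≤ a+d+1≤b , ℕ.≤-trans (ℕ.n≤1+n _) s))

  rootOf-monotone-b : ∀ d {a b} → InRegion (a , b) → InRegion (a , d + b) → rootOf (a , b) ≼ rootOf (a , d + b)
  rootOf-monotone-b zero    _ _ = ≼-refl _
  rootOf-monotone-b (suc d) {a} {b} inR@(a≤b , _) inR′@(_ , s) =
    ≼-trans (rootOf-monotone-b d inR (ℕ.≤-trans a≤b (ℕ.m≤n+m b d) , ℕ.≤-trans (ℕ.+-monoʳ-≤ a (ℕ.n≤1+n _)) s))
            (rootOf-step-b a (d + b) inR′)

  rootOf-monotone : ∀ {a b a′ b′} → InRegion (a , b) → InRegion (a′ , b′) → a′ ≤ a → b ≤ b′ →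
    rootOf (a , b) ≼ rootOf (a′ , b′)
  rootOf-monotone {a} {b} {a′} {b′} inP@(a≤b , a+b≤) inQ a′≤a b≤b′ = ≼-trans
    (subst (λ t → rootOf (t , b) ≼ rootOf (a′ , b)) (ℕ.m∸n+n≡m a′≤a)
      (rootOf-antitone-a (a ∸ a′) (subst (λ t → InRegion (t , b)) (sym (ℕ.m∸n+n≡m a′≤a)) inP)))
    (subst (λ t → rootOf (a′ , b) ≼ rootOf (a′ , t)) (ℕ.m∸n+n≡m b≤b′)
      (rootOf-monotone-b (b′ ∸ b) corner (subst (λ t → InRegion (a′ , t)) (sym (ℕ.m∸n+n≡m b≤b′)) inQ)))
    where
      corner : InRegion (a′ , b)
      corner = ℕ.≤-trans a′≤a a≤b , ℕ.≤-trans (ℕ.+-monoˡ-≤ b a′≤a) a+b≤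

  rootOf-prefixSum : ∀ n P → InRegion P → prefixSum n (rootOf P) ≡ prefixSumᶠ (pointForm P) n
  rootOf-prefixSum n P inP = prefixSum-vec n (pointForm P) (pointForm-valid P inP)

  separated-by-a : ∀ P Q → InRegion P → InRegion Q → proj₁ Q < proj₁ P →
    ∃ λ n → prefixSum n (rootOf P) ℤ.< prefixSum n (rootOf Q)
  separated-by-a P Q inP inQ aQ<aP = suc (proj₁ Q) , (begin-strict
    prefixSum (suc (proj₁ Q)) (rootOf P)             ≡⟨ rootOf-prefixSum _ P inP ⟩
    prefixSumᶠ (pointForm P) (suc (proj₁ Q))         ≡⟨ prefixSumᶠ-below-lead _ _ (pointForm-valid P inP)
                                                           (subst (suc (proj₁ Q) ≤_) (sym (pointForm-lead P)) aQ<aP) ⟩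
    + 0                                              <⟨ subst (λ t → + 0 ℤ.< prefixSumᶠ (pointForm Q) (suc t)) (pointForm-lead Q)
                                                           (prefixSumᶠ-past-lead _ (pointForm-valid Q inQ)) ⟩
    prefixSumᶠ (pointForm Q) (suc (proj₁ Q))         ≡⟨ rootOf-prefixSum _ Q inQ ⟨
    prefixSum (suc (proj₁ Q)) (rootOf Q)             ∎)
    where open ℤ.≤-Reasoning

  private
    separated-at : ∀ P Q → InRegion P → InRegion Q → ∀ n {u v} →
      prefixSumᶠ (pointForm Q) n ≡ u → prefixSumᶠ (pointForm P) n ≡ v → u ℤ.< v →
      ∃ λ n → prefixSum n (rootOf Q) ℤ.< prefixSum n (rootOf P)
    separated-at P Q inP inQ n Qn Pn u<v =
      n , subst₂ ℤ._<_ (sym (trans (rootOf-prefixSum n Q inQ) Qn)) (sym (trans (rootOf-prefixSum n P inP) Pn)) u<v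

    at-point : ∀ {P F} n → pointForm P ≡ F → prefixSumᶠ (pointForm P) n ≡ prefixSumᶠ F n
    at-point n eq = cong (λ F → prefixSumᶠ F n) eq

  separated-by-b : ∀ P Q → InRegion P → InRegion Q → proj₂ Q < proj₂ P →
    ∃ λ n → prefixSum n (rootOf Q) ℤ.< prefixSum n (rootOf P)
  separated-by-b P@(a′ , b′) Q@(a , b) inP@(a′≤b′ , a′+b′≤) inQ@(a≤b , _) b<b′ with ℕ.<-≤-connex b′ r
  ... | inj₁ b′<r = separated-at P Q inP inQ (suc (suc b′))
    (trans (at-point _ (pointForm-below (ℕ.<-trans b<b′ b′<r))) (minus-beyond (s≤s (ℕ.m≤n⇒m≤1+n a≤b)) (s≤s (s≤s b<b′))))
    (trans (at-point _ (pointForm-below b′<r)) (minus-inside (s≤s (ℕ.m≤n⇒m≤1+n a′≤b′)) ℕ.≤-refl))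
    (ℤ.+<+ (s≤s z≤n))
  ... | inj₂ r≤b′ with subst (Valid p) (pointForm-above r≤b′) (pointForm-valid P inP) | ℕ.<-≤-connex b r
  ...   | a′<j′ , j′<p | inj₁ b<r = separated-at P Q inP inQ p
    (trans (at-point _ (pointForm-below b<r)) (minus-beyond (s≤s (ℕ.m≤n⇒m≤1+n a≤b)) (s≤s (s≤s b<r))))
    (trans (at-point _ (pointForm-above r≤b′)) (plus-beyond a′<j′ j′<p))
    (ℤ.+<+ (s≤s z≤n))
  ...   | a′<j′ , _ | inj₂ r≤b with ℕ.<-≤-connex a (suc (suc (r + r) ∸ b′))
  ...     | inj₁ a≤j′ = separated-at P Q inP inQ (suc (suc (r + r) ∸ b′))
    (trans (at-point _ (pointForm-above r≤b)) (plus-inside a≤j′ j′<j))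
    (trans (at-point _ (pointForm-above r≤b′)) (plus-beyond a′<j′ ℕ.≤-refl))
    (ℤ.+<+ (s≤s (s≤s z≤n)))
    where j′<j = ℕ.∸-monoʳ-< b<b′ (ℕ.m≤n⇒m≤1+n (ℕ.≤-trans (ℕ.m≤n+m b′ a′) a′+b′≤))
  ...     | inj₂ j′<a = separated-at P Q inP inQ (suc (suc (r + r) ∸ b′))
    (prefixSumᶠ-below-lead _ (pointForm Q) (pointForm-valid Q inQ) (subst (_ ≤_) (sym (pointForm-lead Q)) j′<a))
    (trans (at-point _ (pointForm-above r≤b′)) (plus-beyond a′<j′ ℕ.≤-refl))
    (ℤ.+<+ (s≤s z≤n))

  rootOf-incomparable : ∀ P Q → InRegion P → InRegion Q → P ≻ Q → ¬ rootOf P ≼ rootOf Q × ¬ rootOf Q ≼ rootOf P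
  rootOf-incomparable P Q inP inQ (aQ<aP , bQ<bP) =
    (λ P≼Q → let n , Q<P = separated-by-b P Q inP inQ bQ<bP in ℤ.<⇒≱ Q<P (≼⇒prefixSum-≤ n P≼Q)) ,
    (λ Q≼P → let n , P<Q = separated-by-a P Q inP inQ aQ<aP in ℤ.<⇒≱ P<Q (≼⇒prefixSum-≤ n Q≼P))

module Correspondence (r : ℕ) where

  open import Defs
  open ListFacts
  open RootForms
  open RegionChains r
  open RegionRoots r
  open ChainCount r using (#chains-total)
  open import Data.Nat as ℕ using (ℕ; suc; _+_; s≤s; _^_)
  open import Data.Nat as ℕ using (ℕ; suc; _+_; s≤s; _^_)
  open import Data.Nat.Combinatorics using (_C_)
  import Data.Nat.Properties as ℕ
  open import Data.Integer as ℤ using (ℤ)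
  import Data.Fin.Properties as Fin
  open import Data.Fin.Subset using (Subset; ∣_∣; _⊆_) renaming (_∈_ to _∈ₛ_)
  import Data.Fin.Subset.Properties as Subset
  import Data.Vec.Properties as Vec
  open import Data.List as List using (List; length; filter)
  open import Data.List.Properties using (length-map)
  open import Data.List.Membership.Propositional using (_∈_; find; lose)
  open import Data.List.Membership.Propositional.Properties using (∈-lookup; ∈-map⁺; ∈-map⁻; ∈-filter⁺)
  open import Data.List.Relation.Unary.Any as Any using (Any; any?)
  import Data.List.Relation.Unary.Any.Properties as Any
  open import Data.List.Relation.Unary.All as All using (All)
  import Data.List.Relation.Unary.All.Properties as All
  open import Data.List.Relation.Unary.AllPairs as AllPairs using (AllPairs)
  import Data.List.Relation.Unary.AllPairs.Properties as AllPairs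
  open import Data.List.Relation.Unary.Unique.Propositional using (Unique)
  import Data.List.Relation.Unary.Unique.Propositional.Properties as Unique
  open import Data.Product using (∃; _×_; _,_; proj₁; proj₂)
  open import Data.Product.Properties using () renaming (≡-dec to ×-≡-dec)
  open import Data.Sum using (inj₁; inj₂)
  open import Data.Empty using (⊥-elim)
  open import Function using (_∘_; _⇔_; mk⇔; Equivalence)
  open import Relation.Nullary using (¬_; Dec; yes; no)
  open import Relation.Nullary.Decidable using (_×-dec_)
  open import Relation.Unary using (Decidable)
  open import Relation.Binary.PropositionalEquality

  _≟ᵥ_ : (u v : V p) → Dec (u ≡ v)
  _≟ᵥ_ = Vec.≡-dec ℤ._≟_

  root-injective : ∀ {x y} → root p x ≡ root p y → x ≡ y
  root-injective {x} {y} = lookup-injective {xs = posRoots p} (posRoots-unique p) x y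

  root-of : ∀ {v} → v ∈ posRoots p → ∃ λ x → root p x ≡ v
  root-of v∈ = Any.index v∈ , sym (Any.lookup-index v∈)

  rootSet : List Point → Subset (N p)
  rootSet c = subsetOf (λ x → any? (λ P → root p x ≟ᵥ rootOf P) c)

  ∈-rootSet⇔ : ∀ {c x} → x ∈ₛ rootSet c ⇔ Any (λ P → root p x ≡ rootOf P) c
  ∈-rootSet⇔ {c} = ∈-subsetOf⇔ (λ x → any? (λ P → root p x ≟ᵥ rootOf P) c)

  IsRegionChain : List Point → Set
  IsRegionChain c = All InRegion c × IsChain c

  ∣rootSet∣ : ∀ {c} → IsRegionChain c → ∣ rootSet c ∣ ≡ length c
  ∣rootSet∣ {c} (inR , chain) = begin
    ∣ rootSet c ∣                                ≡⟨ ∣Γ∣≡length-members (rootSet c) ⟩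
    length (members (rootSet c))                 ≡⟨ length-map (root p) (members (rootSet c)) ⟨
    length (List.map (root p) (members (rootSet c))) ≡⟨ unique-set⇒length≡ roots-unique rootOfs-unique (mk⇔ to from) ⟩
    length (List.map rootOf c)                   ≡⟨ length-map rootOf c ⟩
    length c                                     ∎
    where
      open ≡-Reasoning
      roots-unique = Unique.map⁺ root-injective (members-unique (rootSet c))
      rootOfs-unique = map-unique-on rootOf
        (λ P∈ Q∈ → rootOf-injective _ _ (All.lookup inR P∈) (All.lookup inR Q∈))
        (AllPairs.map (λ { (b<b , _) refl → ℕ.<-irrefl refl b<b }) chain)
      to : ∀ {v} → v ∈ List.map (root p) (members (rootSet c)) → v ∈ List.map rootOf c
      to v∈ with x , x∈ , refl ← ∈-map⁻ (root p) v∈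
            with P , P∈ , x≡P ← find (Equivalence.to ∈-rootSet⇔ (Equivalence.to ∈-members⇔ x∈)) =
        subst (_∈ List.map rootOf c) (sym x≡P) (∈-map⁺ rootOf P∈)
      from : ∀ {v} → v ∈ List.map rootOf c → v ∈ List.map (root p) (members (rootSet c))
      from v∈ with P , P∈ , refl ← ∈-map⁻ rootOf v∈
              with x , x≡P ← root-of (∈-posRoots⁺ (pointForm P) (pointForm-valid P (All.lookup inR P∈))) =
        subst (_∈ List.map (root p) (members (rootSet c))) x≡P
          (∈-map⁺ (root p) (Equivalence.from (∈-members⇔ {x = x}) (Equivalence.from (∈-rootSet⇔ {c} {x}) (lose P∈ x≡P))))

  Counted : ℕ → Subset (N p) → Set
  Counted k Γ = IsShortAntichain p Γ × DisjointΠs p Γ × ∣ Γ ∣ ≡ k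

  _≟ₚ_ : (P Q : Point) → Dec (P ≡ Q)
  _≟ₚ_ = ×-≡-dec ℕ._≟_ ℕ._≟_

  ≻-asym : ∀ {P Q} → P ≻ Q → ¬ Q ≻ P
  ≻-asym (a<a′ , _) (a′<a , _) = ℕ.<-asym a<a′ a′<a

  rootSet-antichain : ∀ {c} → IsRegionChain c → IsAntichain p (rootSet c)
  rootSet-antichain {c} (inR , chain) x y x∈ y∈ x≢y x≼y
    with P , P∈ , x≡P ← find (Equivalence.to ∈-rootSet⇔ x∈)
       | Q , Q∈ , y≡Q ← find (Equivalence.to ∈-rootSet⇔ y∈)
    with P ≟ₚ Q
  ... | yes refl = x≢y (root-injective (trans x≡P (sym y≡Q)))
  ... | no P≢Q with AllPairs-connex chain P∈ Q∈ P≢Q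
  ...   | inj₁ P≻Q = proj₁ (rootOf-incomparable P Q (All.lookup inR P∈) (All.lookup inR Q∈) P≻Q) (subst₂ _≼_ x≡P y≡Q x≼y)
  ...   | inj₂ Q≻P = proj₂ (rootOf-incomparable Q P (All.lookup inR Q∈) (All.lookup inR P∈) Q≻P) (subst₂ _≼_ x≡P y≡Q x≼y)

  rootSet-counted : ∀ {c} → IsRegionChain c → Counted (length c) (rootSet c)
  rootSet-counted {c} chain@(inR , _) = (rootSet-antichain chain , short) , disjoint , ∣rootSet∣ chain
    where
      short : ∀ x → x ∈ₛ rootSet c → IsShort (root p x)
      short x x∈ with P , P∈ , x≡P ← find (Equivalence.to ∈-rootSet⇔ x∈) =
        subst IsShort (sym x≡P) (rootOf-short P (All.lookup inR P∈))
      disjoint : DisjointΠs p (rootSet c)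
      disjoint x x∈ inΠs with P , P∈ , x≡P ← find (Equivalence.to ∈-rootSet⇔ x∈) =
        rootOf-∉Πs P (All.lookup inR P∈) (subst InΠs x≡P inΠs)

  rootSet-injective : ∀ {c c′} → IsRegionChain c → IsRegionChain c′ → rootSet c ≡ rootSet c′ → c ≡ c′
  rootSet-injective {c} {c′} (inR , chain) (inR′ , chain′) same =
    AllPairs-set⇒≡ ≻-asym chain chain′ (mk⇔ (transfer inR inR′ same) (transfer inR′ inR (sym same)))
    where
      transfer : ∀ {c c′} → All InRegion c → All InRegion c′ → rootSet c ≡ rootSet c′ → ∀ {P} → P ∈ c → P ∈ c′
      transfer {c} {c′} inR inR′ same {P} P∈
        with x , x≡P ← root-of (∈-posRoots⁺ (pointForm P) (pointForm-valid P (All.lookup inR P∈)))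
        with Q , Q∈ , x≡Q ← find (Equivalence.to ∈-rootSet⇔ (subst (x ∈ₛ_) same (Equivalence.from (∈-rootSet⇔ {c} {x}) (lose P∈ x≡P))))
        = subst (_∈ c′) (sym (rootOf-injective P Q (All.lookup inR P∈) (All.lookup inR′ Q∈) (trans (sym x≡P) x≡Q))) Q∈

  module _ {Γ : Subset (N p)} (anti : IsAntichain p Γ) (short : ∀ x → x ∈ₛ Γ → IsShort (root p x))
           (disjoint : DisjointΠs p Γ) where

    ∈Γ⇒rootOf : ∀ {x} → x ∈ₛ Γ → ∃ λ P → InRegion P × root p x ≡ rootOf P
    ∈Γ⇒rootOf {x} x∈ with F , vF , x≡F ← ∈-posRoots⁻ (∈-lookup {xs = posRoots p} x)
                     with P , inP , P≡F ← short-nonsimple⇒rootOf F vF (subst IsShort x≡F (short x x∈))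
                                            (λ inΠs → disjoint x x∈ (subst InΠs (sym x≡F) inΠs))
      = P , inP , trans x≡F (sym P≡F)

    RootInΓ : Point → Set
    RootInΓ P = InRegion P × ∃ λ x → x ∈ₛ Γ × root p x ≡ rootOf P

    rootInΓ? : Decidable RootInΓ
    rootInΓ? (a , b) = ((a ℕ.≤? b) ×-dec (a + b ℕ.≤? r + r))
             ×-dec Fin.any? (λ x → (x Subset.∈? Γ) ×-dec (root p x ≟ᵥ rootOf (a , b)))

    -- Opaque, so that unification never unfolds the filter over the grid.
    opaque
      chainOf : List Point
      chainOf = filter rootInΓ? (grid (suc r) (suc (r + r)))

    inRegion⇒inGrid : ∀ {P} → InRegion P → P ∈ grid (suc r) (suc (r + r))
    inRegion⇒inGrid {a , b} inP@(_ , a+b≤) = ∈-grid⁺ (s≤s (lead≤r inP)) (s≤s (ℕ.≤-trans (ℕ.m≤n+m b a) a+b≤))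

    -- Γ is an antichain, so by monotonicity of rootOf its points are strictly ordered in both coordinates.
    lex⇒≻ : ∀ {P Q} → RootInΓ P → RootInΓ Q → LexGt P Q → P ≻ Q
    lex⇒≻ {P@(a , b)} {Q@(a′ , b′)} (inP , x , x∈ , x≡P) (inQ , y , y∈ , y≡Q) P>Q = by-cases P>Q
      where
        x≢y : x ≢ y
        x≢y refl with refl ← rootOf-injective P Q inP inQ (trans (sym x≡P) y≡Q) = lex-irrefl P>Q
          where
            lex-irrefl : ∀ {R} → ¬ LexGt R R
            lex-irrefl (inj₁ a<a)       = ℕ.<-irrefl refl a<a
            lex-irrefl (inj₂ (_ , b<b)) = ℕ.<-irrefl refl b<b
        by-cases : LexGt P Q → P ≻ Q
        by-cases (inj₁ a′<a) with ℕ.<-≤-connex b′ b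
        ... | inj₁ b′<b = a′<a , b′<b
        ... | inj₂ b≤b′ = ⊥-elim (anti x y x∈ y∈ x≢y
                            (subst₂ _≼_ (sym x≡P) (sym y≡Q) (rootOf-monotone inP inQ (ℕ.<⇒≤ a′<a) b≤b′)))
        by-cases (inj₂ (refl , b′<b)) = ⊥-elim (anti y x y∈ x∈ (x≢y ∘ sym)
                            (subst₂ _≼_ (sym y≡Q) (sym x≡P) (rootOf-monotone inQ inP ℕ.≤-refl (ℕ.<⇒≤ b′<b))))

    opaque
      unfolding chainOf

      chainOf-rootInΓ : All RootInΓ chainOf
      chainOf-rootInΓ = All.all-filter rootInΓ? (grid (suc r) (suc (r + r)))

      chainOf-lex : AllPairs LexGt chainOf
      chainOf-lex = AllPairs.filter⁺ rootInΓ? (grid-sorted (suc r) (suc (r + r)))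

      ∈-chainOf⁺ : ∀ {P} → RootInΓ P → P ∈ chainOf
      ∈-chainOf⁺ P-inΓ@(inP , _) = ∈-filter⁺ rootInΓ? (inRegion⇒inGrid inP) P-inΓ

    chainOf-chain : IsRegionChain chainOf
    chainOf-chain = All.map proj₁ chainOf-rootInΓ , AllPairs-upgrade lex⇒≻ chainOf-rootInΓ chainOf-lex

    rootSet-chainOf⊆Γ : rootSet chainOf ⊆ Γ
    rootSet-chainOf⊆Γ {x} x∈ with P , P∈ , x≡P ← find (Equivalence.to ∈-rootSet⇔ x∈)
                             with _ , y , y∈ , y≡P ← All.lookup chainOf-rootInΓ P∈ =
      subst (_∈ₛ Γ) (root-injective {y} {x} (trans y≡P (sym x≡P))) y∈

    Γ⊆rootSet-chainOf : Γ ⊆ rootSet chainOf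
    Γ⊆rootSet-chainOf {x} x∈ = let P , inP , x≡P = ∈Γ⇒rootOf x∈ in
      Equivalence.from (∈-rootSet⇔ {chainOf} {x}) (lose (∈-chainOf⁺ {P} (inP , x , x∈ , x≡P)) x≡P)

    rootSet-chainOf : rootSet chainOf ≡ Γ
    rootSet-chainOf = Subset.⊆-antisym rootSet-chainOf⊆Γ Γ⊆rootSet-chainOf

    chainOf-below : IsChainBelow (suc r) (suc (r + r)) chainOf
    chainOf-below = All.map below chainOf-rootInΓ , proj₂ chainOf-chain
      where
        below : ∀ {P} → RootInΓ P → InRegion P × Below (suc r) (suc (r + r)) P
        below (inP@(_ , a+b≤) , _) = inP , s≤s (lead≤r inP) , s≤s (ℕ.≤-trans (ℕ.m≤n+m _ _) a+b≤)

  countedSubsets : ∀ k → NumberOf (Counted k) ((suc r C k) ^ 2)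
  countedSubsets k = List.map rootSet regionChains , unique , (λ Γ → mk⇔ (sound Γ) (complete Γ)) , count
    where
      regionChains = chains (suc r) (suc (r + r)) k
      isRegionChain : ∀ {c} → c ∈ regionChains → IsRegionChain c
      isRegionChain c∈ with (below , chain) , _ ← chains-sound _ _ k c∈ = All.map proj₁ below , chain
      unique : Unique (List.map rootSet regionChains)
      unique = map-unique-on rootSet (λ c∈ c′∈ → rootSet-injective (isRegionChain c∈) (isRegionChain c′∈))
                                     (chains-unique _ _ k)
      sound : ∀ Γ → Γ ∈ List.map rootSet regionChains → Counted k Γ
      sound Γ Γ∈ with c , c∈ , refl ← ∈-map⁻ rootSet Γ∈ =
        subst (λ n → Counted n (rootSet c)) (proj₂ (chains-sound _ _ k c∈)) (rootSet-counted (isRegionChain c∈))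
      complete : ∀ Γ → Counted k Γ → Γ ∈ List.map rootSet regionChains
      complete Γ ((anti , short) , disjoint , ∣Γ∣≡k) = subst (_∈ List.map rootSet regionChains) (rootSet-chainOf anti short disjoint)
        (∈-map⁺ rootSet (subst (λ n → chainOf anti short disjoint ∈ chains _ _ n) length≡k
          (chains-complete _ _ (chainOf-below anti short disjoint))))
        where
          length≡k : length (chainOf anti short disjoint) ≡ k
          length≡k = trans (sym (∣rootSet∣ (chainOf-chain anti short disjoint)))
                           (trans (cong ∣_∣ (rootSet-chainOf anti short disjoint)) ∣Γ∣≡k)
      count : length (List.map rootSet regionChains) ≡ (suc r C k) ^ 2
      count = trans (length-map rootSet regionChains)
                    (trans (#chains-total k) (cong ((suc r C k) ℕ.*_) (sym (ℕ.*-identityʳ (suc r C k)))))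

mainTheorem17 : (p : ℕ) → 2 ≤ p → (k : ℕ) → k < p →
    NumberOf (λ Γ → IsShortAntichain p Γ × DisjointΠs p Γ × ∣ Γ ∣ ≡ k)
      (((p ∸ 1) C k) ^ 2)
mainTheorem17 (suc zero)    (s≤s ()) _ _
mainTheorem17 (suc (suc r)) _        k _ = Correspondence.countedSubsets r k
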